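{- Let $P$ be a finite Eulerian Sheffer poset of rank $3$. Then: (i) its Sheffer factorial function satisfies $D(2)=2$ and $D(3)=2q$ for some integer $q\geq 2$; (ii) there are integers $q_1,\dots,q_r$ with $q_i\geq 2$ such that $P\cong\boxplus_{i=1,\dots,r}P_{q_i}$, where $P_q$ is the face lattice of a $q$-gon.
   Context: A finite graded poset with minimum $\hat 0$ and maximum $\hat 1$ is Eulerian if every interval $[x,y]$ with $x<y$ has as many elements of even rank as of odd rank. A finite Sheffer poset is a finite poset with $\hat 0$ and $\hat 1$ in which every interval is graded, any two intervals $[\hat 0,y]$, $[\hat 0,v]$ of the same length $n$ have the same number $D(n)$ of maximal chains, and any two intervals $[x,y]$, $[u,v]$ of the same length $n$ with $x\ne\hat 0$, $u\neq \hat 0$ have the same number $B(n)$ of maximal chains; $D$ is the Sheffer factorial function and $B$ the binomial factorial function. The face lattice $P_q$ of a $q$-gon ($q\ge2$) consists of $\hat 0$, atoms $v_1,\dots,v_q$, coatoms $e_1,\dots,e_q$ and $\hat 1$, with $e_i$ covering $v_i$ and $v_{i+1}$ (indices mod $q$); for $q=2$ both coatoms cover both atoms. For posets $Q_1,\dots,Q_r$ with unique minimum and maximum, $\boxplus_{i=1,\dots,r}Q_i$ is obtained from their disjoint union by identifying all minimum elements and identifying all maximum elements. -}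

module Defs where

open import Data.Nat using (ℕ; zero; suc; pred; _≡ᵇ_)
open import Data.Fin using (Fin; toℕ) renaming (_≟_ to _≟F_)
open import Data.Bool using (Bool; true; false; _∧_; _∨_; not; if_then_else_; T)
open import Data.List using (List; []; _∷_; [_]; length; map; concatMap; allFin; filterᵇ)
open import Data.Bool.ListAction using (any)
open import Data.List.Membership.Propositional using (_∈_)
open import Data.List.Relation.Unary.All using (All)
open import Data.Product using (Σ; _×_)
open import Function.Bundles using (_↔_; Inverse)
open import Relation.Binary.PropositionalEquality using (_≡_; _≢_; refl)
open import Relation.Binary.Definitions using (DecidableEquality)
open import Relation.Nullary.Decidable using (⌊_⌋; yes; no)

record FinPoset : Set where
  field
    size    : ℕ
    le      : Fin size → Fin size → Bool
    le-refl  : ∀ x → T (le x x)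
    le-antisym : ∀ x y → T (le x y) → T (le y x) → x ≡ y
    le-trans : ∀ x y z → T (le x y) → T (le y z) → T (le x z)
    bot     : Fin size
    top     : Fin size
    bot-min : ∀ x → T (le bot x)
    top-max : ∀ x → T (le x top)

module _ (P : FinPoset) where
  open FinPoset P

  eqF : Fin size → Fin size → Bool
  eqF x y = ⌊ x ≟F y ⌋

  lt : Fin size → Fin size → Bool
  lt x y = le x y ∧ not (eqF x y)

  covers : Fin size → Fin size → Bool
  covers x y = lt x y ∧ not (any (λ z → lt x z ∧ lt z y) (allFin size))

  chainsF : ℕ → Fin size → Fin size → List (List (Fin size))
  chainsF zero x y = if eqF x y then [ x ∷ [] ] else []
  chainsF (suc k) x y =
    if eqF x y then [ x ∷ [] ]
    else concatMap (λ z → if covers x z ∧ le z y then map (x ∷_) (chainsF k z y) else [])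
                   (allFin size)

  -- all maximal chains of the interval [x,y] (a saturated chain has at most
  -- `size` distinct elements, hence at most size - 1 cover steps)
  maxChains : Fin size → Fin size → List (List (Fin size))
  maxChains x y = chainsF size x y

  numChains : Fin size → Fin size → ℕ
  numChains x y = length (maxChains x y)

  GradedInterval : Fin size → Fin size → Set
  GradedInterval x y = ∀ {c c′} → c ∈ maxChains x y → c′ ∈ maxChains x y → length c ≡ length c′

  IntervalLength : Fin size → Fin size → ℕ → Set
  IntervalLength x y k = T (le x y) × All (λ c → length c ≡ suc k) (maxChains x y)

  -- rank of z in [x, _] (length of [x,z]; well defined when [x,z] is graded)
  rankIn : Fin size → Fin size → ℕ
  rankIn x z with maxChains x z
  ... | [] = 0
  ... | c ∷ _ = pred (length c)

  isEven : ℕ → Bool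
  isEven zero = true
  isEven (suc n) = not (isEven n)

  countRankParity : Bool → Fin size → Fin size → ℕ
  countRankParity b x y =
    length (filterᵇ (λ z → le x z ∧ le z y ∧ ⌊ Data.Bool._≟_ (isEven (rankIn x z)) b ⌋) (allFin size))

  record IsEulerian : Set where
    field
      graded : ∀ x y → GradedInterval x y
      euler  : ∀ x y → T (lt x y) → countRankParity true x y ≡ countRankParity false x y

  record IsSheffer (D B : ℕ → ℕ) : Set where
    field
      graded : ∀ x y → GradedInterval x y
      D-spec : ∀ y k → IntervalLength bot y k → numChains bot y ≡ D k
      B-spec : ∀ x y k → x ≢ bot → IntervalLength x y k → numChains x y ≡ B k

record BOrd : Set₁ where
  field
    Carrier : Set
    leq     : Carrier → Carrier → Bool
    bottom  : Carrier
    topp    : Carrier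

Iso : FinPoset → BOrd → Set
Iso P Q = Σ (Fin (FinPoset.size P) ↔ BOrd.Carrier Q) λ f →
  ∀ x y → FinPoset.le P x y ≡ BOrd.leq Q (Inverse.to f x) (Inverse.to f y)

-- Face lattice P_q of a q-gon: 0̂, vertices v_j, edges e_j, 1̂ (j ∈ Fin q);
-- e_j covers v_j and v_{j+1} (indices mod q).

data Face (q : ℕ) : Set where
  f0̂ f1̂ : Face q
  vtx edge : Fin q → Face q

isNext : {q : ℕ} → Fin q → Fin q → Bool
isNext {q} j i = (toℕ i ≡ᵇ suc (toℕ j)) ∨ ((toℕ i ≡ᵇ 0) ∧ (suc (toℕ j) ≡ᵇ q))

leFace : {q : ℕ} → Face q → Face q → Bool
leFace f0̂ _ = true
leFace f1̂ f1̂ = true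
leFace f1̂ _ = false
leFace (vtx i) f0̂ = false
leFace (vtx i) f1̂ = true
leFace (vtx i) (vtx j) = ⌊ i ≟F j ⌋
leFace (vtx i) (edge j) = ⌊ i ≟F j ⌋ ∨ isNext j i
leFace (edge i) f0̂ = false
leFace (edge i) f1̂ = true
leFace (edge i) (vtx j) = false
leFace (edge i) (edge j) = ⌊ i ≟F j ⌋

faceLattice : ℕ → BOrd
faceLattice q = record { Carrier = Face q ; leq = leFace ; bottom = f0̂ ; topp = f1̂ }

faceEq : (q : ℕ) → DecidableEquality (Face q)
faceEq q f0̂ f0̂ = yes refl
faceEq q f0̂ f1̂ = no λ ()
faceEq q f0̂ (vtx _) = no λ ()
faceEq q f0̂ (edge _) = no λ ()
faceEq q f1̂ f0̂ = no λ ()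
faceEq q f1̂ f1̂ = yes refl
faceEq q f1̂ (vtx _) = no λ ()
faceEq q f1̂ (edge _) = no λ ()
faceEq q (vtx _) f0̂ = no λ ()
faceEq q (vtx _) f1̂ = no λ ()
faceEq q (vtx i) (vtx j) with i ≟F j
... | yes refl = yes refl
... | no ne = no λ { refl → ne refl }
faceEq q (vtx _) (edge _) = no λ ()
faceEq q (edge _) f0̂ = no λ ()
faceEq q (edge _) f1̂ = no λ ()
faceEq q (edge _) (vtx _) = no λ ()
faceEq q (edge i) (edge j) with i ≟F j
... | yes refl = yes refl
... | no ne = no λ { refl → ne refl }

-- ⊞_{i} Q_i : disjoint union of the Q_i with all minima identified and all
-- maxima identified.

module _ {r : ℕ} (Q : Fin r → BOrd) (eq : ∀ i → DecidableEquality (BOrd.Carrier (Q i))) where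

  interior : (i : Fin r) → BOrd.Carrier (Q i) → Bool
  interior i x = not ⌊ eq i x (BOrd.bottom (Q i)) ⌋ ∧ not ⌊ eq i x (BOrd.topp (Q i)) ⌋

  data BoxElem : Set where
    b0̂ b1̂ : BoxElem
    inner : (i : Fin r) (x : BOrd.Carrier (Q i)) → T (interior i x) → BoxElem

  leInner : (i j : Fin r) → BOrd.Carrier (Q i) → BOrd.Carrier (Q j) → Bool
  leInner i j x y with i ≟F j
  ... | yes refl = BOrd.leq (Q i) x y
  ... | no _ = false

  leBox : BoxElem → BoxElem → Bool
  leBox b0̂ _ = true
  leBox b1̂ b1̂ = true
  leBox b1̂ _ = false
  leBox (inner i x _) b0̂ = false
  leBox (inner i x _) b1̂ = true
  leBox (inner i x _) (inner j y _) = leInner i j x y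

  boxplus : BOrd
  boxplus = record { Carrier = BoxElem ; leq = leBox ; bottom = b0̂ ; topp = b1̂ }

module Submission where

open import Defs
open import Data.Nat using (ℕ; _≤_; _*_)
open import Data.Fin using (Fin)
open import Data.Product using (Σ; _×_)
open import Relation.Binary.PropositionalEquality using (_≡_)

open import Data.Nat
open import Data.Nat.Properties
open import Data.Nat.DivMod using (_%_; _/_; m≡m%n+[m/n]*n; m%n<n; n%n≡0)
open import Data.Nat.Tactic.RingSolver using (solve-∀)
open import Data.Bool using (Bool; true; false; _∧_; _∨_; not; if_then_else_; T)
  renaming (_≟_ to _≟B_)
open import Data.Bool.ListAction using (any)
open import Data.Bool.Properties using (T-≡; T-∧; T-∨; ⇔→≡; ∧-assoc)
open import Data.Empty using (⊥; ⊥-elim)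
open import Data.Unit using (tt)
open import Data.Product using (_,_; proj₁; proj₂)
open import Data.Product.Properties using (≡-dec)
open import Data.Sum using (_⊎_; inj₁; inj₂)
open import Data.Fin as Fin using (toℕ; fromℕ<; combine) renaming (_≟_ to _≟F_)
open import Data.Fin.Properties using (pigeonhole; combine-injective; toℕ-injective; toℕ<n; toℕ-fromℕ<; all?)
open import Data.List using (List; []; _∷_; [_]; length; map; concatMap; filterᵇ; allFin; lookup; upTo)
open import Data.List.Properties using (length-++; length-map; length-tabulate)
open import Data.List.Extrema ≤-totalOrder using (argmin; argmin-all; f[argmin]≤f[xs])
open import Data.List.Membership.Propositional using (_∈_; lose)
open import Data.List.Membership.Propositional.Properties
  using (∈-filter⁺; ∈-filter⁻; ∈-lookup; ∈-allFin; ∈-map⁺; ∈-concatMap⁺; ∈-upTo⁺)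
open import Data.List.Relation.Unary.Any as Any using (here; there; satisfied)
open import Data.List.Relation.Unary.Any.Properties using (any⁺; any⁻; lookup-index)
open import Data.List.Relation.Unary.All as All using (All; []; _∷_)
open import Data.List.Relation.Unary.All.Properties as All using (concat⁺; map⁺)
open import Data.List.Relation.Unary.AllPairs using (_∷_)
open import Data.List.Relation.Unary.Unique.Propositional using (Unique)
import Data.List.Relation.Unary.Unique.Propositional.Properties as Unique
open import Function.Bundles using (Equivalence; mk⇔; mk↔ₛ′)
open import Relation.Binary.PropositionalEquality
  using (_≢_; refl; sym; trans; cong; cong₂; subst; module ≡-Reasoning)
open import Relation.Binary.Definitions using (DecidableEquality; tri<; tri≈; tri>)
open import Relation.Nullary.Decidable using (⌊_⌋; yes; no; T?; toWitness; fromWitness)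

-- In an Eulerian poset an interval of length two has exactly two interior elements
-- (the diamond property: its elements of even rank are its two ends).  In rank 3 every
-- element is 0̂, 1̂, an atom or a coatom, so each coatom covers exactly two atoms and each
-- atom is covered by exactly two coatoms; counting chains gives D(2) = 2, D(3) = 2·#atoms.
-- Such a 2-regular atom–coatom incidence splits into cycles: on flags (atom, coatom),
-- alternately replacing the atom and then the coatom by the other one traces each cycle;
-- numbering the cycles by their least atom and reading cycle i as a q_i-gon gives the
-- isomorphism.

≡→T : ∀ {b} → b ≡ true → T b
≡→T = Equivalence.from T-≡

T→≡ : ∀ {b} → T b → b ≡ true
T→≡ = Equivalence.to T-≡

¬T→≡false : ∀ {b} → (T b → ⊥) → b ≡ false
¬T→≡false {true} ¬t = ⊥-elim (¬t tt)
¬T→≡false {false} _ = refl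

∧-intro : ∀ {a b} → T a → T b → T (a ∧ b)
∧-intro p q = Equivalence.from T-∧ (p , q)

∧-fst : ∀ {a b} → T (a ∧ b) → T a
∧-fst {a} {b} t = proj₁ (Equivalence.to (T-∧ {a} {b}) t)

∧-snd : ∀ {a b} → T (a ∧ b) → T b
∧-snd {a} {b} t = proj₂ (Equivalence.to (T-∧ {a} {b}) t)

∨-inj₁ : ∀ {a b} → T a → T (a ∨ b)
∨-inj₁ t = Equivalence.from T-∨ (inj₁ t)

∨-inj₂ : ∀ {a b} → T b → T (a ∨ b)
∨-inj₂ {a} t = Equivalence.from (T-∨ {a}) (inj₂ t)

∨-elim : ∀ {a b} → T (a ∨ b) → T a ⊎ T b
∨-elim {a} {b} = Equivalence.to (T-∨ {a} {b})

bool-ext : ∀ {a b : Bool} → (T a → T b) → (T b → T a) → a ≡ b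
bool-ext f g = ⇔→≡ {z = true} (mk⇔ (λ e → T→≡ (f (≡→T e))) (λ e → T→≡ (g (≡→T e))))

module _ {A : Set} where

  count : (A → Bool) → List A → ℕ
  count p xs = length (filterᵇ p xs)

  count-cong : ∀ {p q : A → Bool} xs → (∀ x → p x ≡ q x) → count p xs ≡ count q xs
  count-cong [] _ = refl
  count-cong {p} {q} (x ∷ xs) p≡q with p x | q x | p≡q x
  ... | true  | .true  | refl = cong suc (count-cong xs p≡q)
  ... | false | .false | refl = count-cong xs p≡q

  count-mono : ∀ {p q : A → Bool} xs → (∀ x → T (p x) → T (q x)) → count p xs ≤ count q xs
  count-mono [] _ = z≤n
  count-mono {p} {q} (x ∷ xs) p⇒q with p x in px | q x in qx
  ... | true  | true  = s≤s (count-mono xs p⇒q)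
  ... | true  | false = ⊥-elim (subst T qx (p⇒q x (≡→T px)))
  ... | false | true  = m≤n⇒m≤1+n (count-mono xs p⇒q)
  ... | false | false = count-mono xs p⇒q

  count-< : ∀ {p r : A → Bool} {u xs} → u ∈ xs → T (r u) → (T (p u) → ⊥) →
    (∀ x → T (p x) → T (r x)) → count p xs < count r xs
  count-< {p} {r} {xs = x ∷ xs} (here refl) ru ¬pu p⇒r with p x in px | r x in rx
  ... | true  | _     = ⊥-elim (¬pu tt)
  ... | false | true  = s≤s (count-mono xs p⇒r)
  ... | false | false = ⊥-elim ru
  count-< {p} {r} {xs = x ∷ xs} (there u∈) ru ¬pu p⇒r with p x in px | r x in rx
  ... | true  | true  = s≤s (count-< u∈ ru ¬pu p⇒r)
  ... | true  | false = ⊥-elim (subst T rx (p⇒r x (≡→T px)))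
  ... | false | true  = m<n⇒m<1+n (count-< u∈ ru ¬pu p⇒r)
  ... | false | false = count-< u∈ ru ¬pu p⇒r

  count-∨ : ∀ {p q : A → Bool} xs → (∀ x → T (p x) → T (q x) → ⊥) →
    count (λ x → p x ∨ q x) xs ≡ count p xs + count q xs
  count-∨ [] _ = refl
  count-∨ {p} {q} (x ∷ xs) d with p x in ep | q x in eq
  ... | true  | true  = ⊥-elim (d x (≡→T ep) (≡→T eq))
  ... | true  | false = cong suc (count-∨ xs d)
  ... | false | true  = trans (cong suc (count-∨ xs d)) (sym (+-suc (count p xs) (count q xs)))
  ... | false | false = count-∨ xs d

  count-≤-length : ∀ (p : A → Bool) xs → count p xs ≤ length xs
  count-≤-length p [] = z≤n
  count-≤-length p (x ∷ xs) with p x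
  ... | true  = s≤s (count-≤-length p xs)
  ... | false = m≤n⇒m≤1+n (count-≤-length p xs)

  ∈-filterᵇ⁺ : ∀ {p : A → Bool} {x xs} → x ∈ xs → T (p x) → x ∈ filterᵇ p xs
  ∈-filterᵇ⁺ {p} = ∈-filter⁺ (λ x → T? (p x))

  ∈-filterᵇ⁻ : ∀ {p : A → Bool} {x} xs → x ∈ filterᵇ p xs → x ∈ xs × T (p x)
  ∈-filterᵇ⁻ {p} xs = ∈-filter⁻ (λ x → T? (p x)) {xs = xs}

  count-pos : ∀ {p : A → Bool} {x xs} → x ∈ xs → T (p x) → 1 ≤ count p xs
  count-pos {p} {x} {xs} x∈ px with filterᵇ p xs | ∈-filterᵇ⁺ {p} x∈ px
  ... | _ ∷ _ | _ = s≤s z≤n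

  count-one : ∀ (p : A → Bool) {xs u} → Unique xs → u ∈ xs → T (p u) →
    (∀ x → T (p x) → x ≡ u) → count p xs ≡ 1
  count-one p {xs} {u} uq u∈ pu only with filterᵇ p xs in e | Unique.filter⁺ (λ x → T? (p x)) uq
  ... | [] | _ with () ← subst (_ ∈_) e (∈-filterᵇ⁺ {p} u∈ pu)
  ... | _ ∷ [] | _ = refl
  ... | a ∷ b ∷ rest | (a≢b ∷ _) ∷ _ = ⊥-elim (a≢b (trans (from (here refl)) (sym (from (there (here refl))))))
    where
    from : ∀ {y} → y ∈ a ∷ b ∷ rest → y ≡ u
    from {y} y∈ = only y (proj₂ (∈-filterᵇ⁻ xs (subst (y ∈_) (sym e) y∈)))

  count-two : ∀ (p : A → Bool) {xs} → Unique xs → count p xs ≡ 2 →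
    Σ A λ u → Σ A λ v → filterᵇ p xs ≡ u ∷ v ∷ [] × u ≢ v
  count-two p {xs} uq c2 with filterᵇ p xs | Unique.filter⁺ (λ x → T? (p x)) uq
  ... | u ∷ v ∷ [] | (u≢v ∷ _) ∷ _ = u , v , refl , u≢v

length-concatMap : ∀ {A B : Set} (f : A → List B) (p : A → Bool) (m : ℕ) xs →
  (∀ x → T (p x) → length (f x) ≡ m) → (∀ x → p x ≡ false → f x ≡ []) →
  length (concatMap f xs) ≡ m * count p xs
length-concatMap f p m [] _ _ = sym (*-zeroʳ m)
length-concatMap f p m (x ∷ xs) on off with p x in px
... | true  = trans (length-++ (f x)) (trans (cong₂ _+_ (on x (≡→T px)) (length-concatMap f p m xs on off))
                                              (sym (*-suc m (count p xs))))
... | false = trans (length-++ (f x)) (cong₂ _+_ (cong length (off x px)) (length-concatMap f p m xs on off))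

lookup-injective : ∀ {A : Set} (xs : List A) → Unique xs → ∀ i j → lookup xs i ≡ lookup xs j → i ≡ j
lookup-injective (x ∷ xs) _ Fin.zero Fin.zero _ = refl
lookup-injective (x ∷ xs) (x∉ ∷ _) Fin.zero (Fin.suc j) e = ⊥-elim (All.lookup x∉ (∈-lookup j) e)
lookup-injective (x ∷ xs) (x∉ ∷ _) (Fin.suc i) Fin.zero e = ⊥-elim (All.lookup x∉ (∈-lookup i) (sym e))
lookup-injective (x ∷ xs) (_ ∷ uq) (Fin.suc i) (Fin.suc j) e = cong Fin.suc (lookup-injective xs uq i j e)

module Poset (P : FinPoset) where
  open FinPoset P public

  X : Set
  X = Fin size

  eqF-refl : ∀ x → eqF P x x ≡ true
  eqF-refl x with x ≟F x
  ... | yes _ = refl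
  ... | no x≢x = ⊥-elim (x≢x refl)

  eqF-≢ : ∀ {x y} → x ≢ y → eqF P x y ≡ false
  eqF-≢ {x} {y} x≢y with x ≟F y
  ... | yes x≡y = ⊥-elim (x≢y x≡y)
  ... | no _ = refl

  eqF-≡ : ∀ {x y} → T (eqF P x y) → x ≡ y
  eqF-≡ {x} {y} t with x ≟F y
  ... | yes x≡y = x≡y

  lt-le : ∀ {x y} → T (lt P x y) → T (le x y)
  lt-le = ∧-fst

  lt-≢ : ∀ {x y} → T (lt P x y) → x ≢ y
  lt-≢ {x} t refl with eqF P x x | eqF-refl x | ∧-snd {le x x} t
  ... | true | refl | ()

  lt-intro : ∀ {x y} → T (le x y) → x ≢ y → T (lt P x y)
  lt-intro x≤y x≢y = ∧-intro x≤y (subst (λ b → T (not b)) (sym (eqF-≢ x≢y)) tt)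

  lt-≤-trans : ∀ {x y z} → T (lt P x y) → T (le y z) → T (lt P x z)
  lt-≤-trans {x} {y} {z} x<y y≤z = lt-intro (le-trans x y z (lt-le x<y) y≤z)
    λ { refl → lt-≢ x<y (le-antisym x y (lt-le x<y) y≤z) }

  ≤-lt-trans : ∀ {x y z} → T (le x y) → T (lt P y z) → T (lt P x z)
  ≤-lt-trans {x} {y} {z} x≤y y<z = lt-intro (le-trans x y z x≤y (lt-le y<z))
    λ { refl → lt-≢ y<z (le-antisym y x (lt-le y<z) x≤y) }

  ≤-antisym-top : ∀ {x} → T (le top x) → x ≡ top
  ≤-antisym-top {x} t = le-antisym x top (top-max x) t

  ≤-antisym-bot : ∀ {x} → T (le x bot) → x ≡ bot
  ≤-antisym-bot {x} t = le-antisym x bot t (bot-min x)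

  covers-lt : ∀ {x y} → T (covers P x y) → T (lt P x y)
  covers-lt = ∧-fst

  covers-empty : ∀ {x y z} → T (covers P x y) → T (lt P x z) → T (lt P z y) → ⊥
  covers-empty {x} {y} {z} x⋖y x<z z<y with any (λ w → lt P x w ∧ lt P w y) (allFin size)
    | any⁺ (λ w → lt P x w ∧ lt P w y) (lose (∈-allFin z) (∧-intro x<z z<y))
  ... | true | _ with () ← ∧-snd {lt P x y} x⋖y

  covers-intro : ∀ {x y} → T (lt P x y) → (∀ z → T (lt P x z) → T (lt P z y) → ⊥) → T (covers P x y)
  covers-intro {x} {y} x<y empty = ∧-intro x<y (not-any (any (λ w → lt P x w ∧ lt P w y) (allFin size)) refl)
    where
    not-any : ∀ b → any (λ w → lt P x w ∧ lt P w y) (allFin size) ≡ b → T (not b)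
    not-any true e = let (z , t) = satisfied (any⁻ _ (allFin size) (subst T (sym e) tt))
                     in empty z (∧-fst t) (∧-snd {lt P x z} t)
    not-any false _ = tt

  between : ∀ {x y} → T (lt P x y) → (T (covers P x y) → ⊥) → Σ X λ z → T (lt P x z) × T (lt P z y)
  between {x} {y} x<y ¬x⋖y with any (λ w → lt P x w ∧ lt P w y) (allFin size) in e
  ... | true  = let (z , t) = satisfied (any⁻ _ (allFin size) (≡→T e)) in z , ∧-fst t , ∧-snd {lt P x z} t
  ... | false = ⊥-elim (¬x⋖y (∧-intro x<y tt))

  data Chain : ℕ → X → X → List X → Set where
    [_]ᶜ : ∀ x → Chain 0 x x (x ∷ [])
    _⋖_∷_ : ∀ {k x y z c} → x ≢ y → T (covers P x z) × T (le z y) → Chain k z y c → Chain (suc k) x y (x ∷ c)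

  chain-le : ∀ {k x y c} → Chain k x y c → T (le x y)
  chain-le [ x ]ᶜ = le-refl x
  chain-le {x = x} {y} (_⋖_∷_ {z = z} _ (x⋖z , z≤y) _) = le-trans x z y (lt-le (covers-lt x⋖z)) z≤y

  chain-length : ∀ {k x y c} → Chain k x y c → length c ≡ suc k
  chain-length [ x ]ᶜ = refl
  chain-length (_ ⋖ _ ∷ c) = cong suc (chain-length c)

  chain-zero : ∀ {x y c} → Chain 0 x y c → x ≡ y
  chain-zero [ x ]ᶜ = refl

  chain-one : ∀ {x y c} → Chain 1 x y c → T (covers P x y)
  chain-one (_ ⋖ (x⋖z , _) ∷ rest) with chain-zero rest
  ... | refl = x⋖z

  chain-++ : ∀ {k k′ x y z c c′} → Chain k x y c → Chain k′ y z c′ → Σ (List X) (Chain (k + k′) x z)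
  chain-++ [ x ]ᶜ rest = _ , rest
  chain-++ {z = z} (_⋖_∷_ {z = w} _ (x⋖w , w≤y) c) c′ =
    let w≤z = le-trans w _ z w≤y (chain-le c′) in
    _ , ((λ { refl → lt-≢ (lt-≤-trans (covers-lt x⋖w) w≤z) refl }) ⋖ (x⋖w , w≤z) ∷ proj₂ (chain-++ c c′))

  -- #(x,y]: the number of elements w with x < w ≤ y.  It bounds chain lengths.
  #⟨_,_] : X → X → ℕ
  #⟨ x , y ] = count (λ w → lt P x w ∧ le w y) (allFin size)

  #≤size : ∀ x y → #⟨ x , y ] ≤ size
  #≤size x y = ≤-trans (count-≤-length _ (allFin size)) (≤-reflexive (length-tabulate (λ i → i)))

  -- Removing the bottom part: for x < z ≤ y, (z,y] misses z ∈ (x,y].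
  #-shrinkˡ : ∀ {x z y} → T (lt P x z) → T (le z y) → #⟨ z , y ] < #⟨ x , y ]
  #-shrinkˡ {x} {z} {y} x<z z≤y = count-< (∈-allFin z) (∧-intro x<z z≤y) (λ t → lt-≢ (∧-fst t) refl)
    (λ w t → ∧-intro (lt-≤-trans x<z (lt-le (∧-fst t))) (∧-snd {lt P z w} t))

  -- Removing the top part: for x ≤ z < y, (x,z] misses y ∈ (x,y].
  #-shrinkʳ : ∀ {x z y} → T (le x z) → T (lt P z y) → #⟨ x , z ] < #⟨ x , y ]
  #-shrinkʳ {x} {z} {y} x≤z z<y =
    count-< (∈-allFin y) (∧-intro (≤-lt-trans x≤z z<y) (le-refl y))
      (λ t → lt-≢ z<y (le-antisym z y (lt-le z<y) (∧-snd {lt P x y} t)))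
      (λ w t → ∧-intro (∧-fst t) (le-trans w z y (∧-snd {lt P x w} t) (lt-le z<y)))

  chain-bound : ∀ {k x y c} → Chain k x y c → k ≤ #⟨ x , y ]
  chain-bound [ x ]ᶜ = z≤n
  chain-bound (_ ⋖ (x⋖z , z≤y) ∷ c) = ≤-trans (s≤s (chain-bound c)) (#-shrinkˡ (covers-lt x⋖z) z≤y)

  chain-≤size : ∀ {k x y c} → Chain k x y c → k ≤ size
  chain-≤size {x = x} {y} c = ≤-trans (chain-bound c) (#≤size x y)

  -- Any x ≤ y is joined by a saturated chain: either x ⋖ y, or some z lies strictly
  -- between and both halves have smaller #(_,_] (the fuel f bounds #(x,y]).
  saturated : ∀ f {x y} → T (le x y) → #⟨ x , y ] ≤ f → Σ ℕ λ k → Σ (List X) (Chain k x y)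
  saturated f {x} {y} x≤y bound with x ≟F y
  ... | yes refl = 0 , _ , [ x ]ᶜ
  ... | no x≢y with covers P x y in x⋖y
  ...   | true = 1 , _ , (x≢y ⋖ (≡→T x⋖y , le-refl y) ∷ [ y ]ᶜ)
  saturated zero {x} {y} x≤y bound | no x≢y | false =
    ⊥-elim (n≮0 (≤-trans (#-shrinkʳ (le-refl x) (lt-intro x≤y x≢y)) bound))
  saturated (suc f) {x} {y} x≤y bound | no x≢y | false =
    let (z , x<z , z<y) = between (lt-intro x≤y x≢y) (λ t → subst T x⋖y t)
        (k₁ , _ , c₁) = saturated f (lt-le x<z) (≤-pred (≤-trans (#-shrinkʳ (lt-le x<z) z<y) bound))
        (k₂ , _ , c₂) = saturated f (lt-le z<y) (≤-pred (≤-trans (#-shrinkˡ x<z (lt-le z<y)) bound))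
    in k₁ + k₂ , chain-++ c₁ c₂

  saturated-chain : ∀ {x y} → T (le x y) → Σ ℕ λ k → Σ (List X) (Chain k x y)
  saturated-chain {x} {y} x≤y = saturated size x≤y (#≤size x y)

  chainsF-refl : ∀ f x → chainsF P f x x ≡ [ x ∷ [] ]
  chainsF-refl zero x rewrite eqF-refl x = refl
  chainsF-refl (suc f) x rewrite eqF-refl x = refl

  upCovers : X → X → X → Bool
  upCovers x y z = covers P x z ∧ le z y

  branch : ℕ → X → X → X → List (List X)
  branch f x y z = if upCovers x y z then map (x ∷_) (chainsF P f z y) else []

  chainsF-step : ∀ f {x y} → x ≢ y → chainsF P (suc f) x y ≡ concatMap (branch f x y) (allFin size)
  chainsF-step f x≢y rewrite eqF-≢ x≢y = refl

  chain-∈ : ∀ {f k x y c} → Chain k x y c → k ≤ f → c ∈ chainsF P f x y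
  chain-∈ {f} [ x ]ᶜ _ rewrite chainsF-refl f x = here refl
  chain-∈ {suc f} {x = x} {y} (_⋖_∷_ {z = z} x≢y (x⋖z , z≤y) c) (s≤s k≤f) rewrite chainsF-step f x≢y =
    ∈-concatMap⁺ (branch f x y) (lose (∈-allFin z) (on-branch (T→≡ (∧-intro x⋖z z≤y))))
    where
    on-branch : upCovers x y z ≡ true → _ ∈ branch f x y z
    on-branch e rewrite e = ∈-map⁺ (x ∷_) (chain-∈ c k≤f)

  chain-maximal : ∀ {k x y c} → Chain k x y c → c ∈ maxChains P x y
  chain-maximal c = chain-∈ c (chain-≤size c)

  Shape : ℕ → X → X → ℕ → ℕ → Set
  Shape f x y m N = All (λ c → length c ≡ suc m) (chainsF P f x y) × length (chainsF P f x y) ≡ N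

  shape-refl : ∀ f x → Shape f x x 0 1
  shape-refl f x rewrite chainsF-refl f x = refl ∷ [] , refl

  -- The chains from x are the chains from its covers z in [x,y], prefixed by x.
  shape-step : ∀ f {x y m N M} → x ≢ y → (∀ z → T (upCovers x y z) → Shape f z y m N) →
    N * count (upCovers x y) (allFin size) ≡ M → Shape (suc f) x y (suc m) M
  shape-step f {x} {y} {m} {N} x≢y shape eq rewrite chainsF-step f x≢y =
    concat⁺ (map⁺ (All.universal branch-all (allFin size))) ,
    trans (length-concatMap (branch f x y) (upCovers x y) N (allFin size) branch-length branch-off) eq
    where
    branch-all : ∀ z → All (λ c → length c ≡ suc (suc m)) (branch f x y z)
    branch-all z with upCovers x y z in e
    ... | true  = map⁺ (All.map (cong suc) (proj₁ (shape z (≡→T e))))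
    ... | false = []

    branch-length : ∀ z → T (upCovers x y z) → length (branch f x y z) ≡ N
    branch-length z t rewrite T→≡ {upCovers x y z} t =
      trans (length-map (x ∷_) (chainsF P f z y)) (proj₂ (shape z t))

    branch-off : ∀ z → upCovers x y z ≡ false → branch f x y z ≡ []
    branch-off z e rewrite e = refl

  shape-cover : ∀ {x y} → T (covers P x y) → ∀ f → Shape (1 + f) x y 1 1
  shape-cover {x} {y} x⋖y f =
    shape-step f {m = 0} {N = 1} (lt-≢ (covers-lt x⋖y))
      (λ z t → subst (λ w → Shape f w y 0 1) (sym (only-y z t)) (shape-refl f y))
      (trans (*-identityˡ _)
             (count-one (upCovers x y) (Unique.allFin⁺ size) (∈-allFin y) (∧-intro x⋖y (le-refl y)) only-y))
    where
    only-y : ∀ z → T (upCovers x y z) → z ≡ y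
    only-y z t with z ≟F y
    ... | yes z≡y = z≡y
    ... | no z≢y = ⊥-elim (covers-empty x⋖y (covers-lt (∧-fst t)) (lt-intro (∧-snd {covers P x z} t) z≢y))

  shape-two : ∀ {x y} → x ≢ y → (∀ z → T (upCovers x y z) → T (covers P z y)) →
    ∀ f → Shape (2 + f) x y 2 (count (upCovers x y) (allFin size))
  shape-two x≢y up f = shape-step (suc f) {m = 1} {N = 1} x≢y (λ z t → shape-cover (up z t) f) (*-identityˡ _)

  shape-at-size : ∀ {x y m N} → m ≤ size → (∀ f → Shape (m + f) x y m N) → Shape size x y m N
  shape-at-size {x} {y} {m} {N} m≤size shape = subst (λ f → Shape f x y m N) (m+[n∸m]≡n m≤size) (shape (size ∸ m))

  rank-from-shape : ∀ {x y m N} → Shape size x y m N → 1 ≤ N → rankIn P x y ≡ m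
  rank-from-shape {x} {y} shape N≥1 with maxChains P x y
  rank-from-shape ([] , refl) () | []
  rank-from-shape (len ∷ _ , _) N≥1 | c ∷ _ = cong pred len

  count-eqF : ∀ u → count (λ z → eqF P z u) (allFin size) ≡ 1
  count-eqF u = count-one (λ z → eqF P z u) (Unique.allFin⁺ size) (∈-allFin u) (≡→T (eqF-refl u)) (λ z t → eqF-≡ t)

  -- Its elements of even rank are x and y, those of odd
  -- rank are the interior ones, so the Euler relation gives 2 = #interior.
  module Diamond (eulerian : IsEulerian P) {x y : X} (x<y : T (lt P x y))
    (interior : ∀ z → T (lt P x z) → T (lt P z y) → T (covers P x z) × T (covers P z y))
    (witness : Σ X λ z → T (lt P x z) × T (lt P z y)) where

    open IsEulerian eulerian using (euler)

    x≢y : x ≢ y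
    x≢y = lt-≢ x<y

    ¬x⋖y : T (covers P x y) → ⊥
    ¬x⋖y x⋖y = let (z , x<z , z<y) = witness in covers-empty x⋖y x<z z<y

    up-covered : ∀ z → T (upCovers x y z) → T (covers P z y)
    up-covered z t = proj₂ (interior z x<z (lt-intro (∧-snd {covers P x z} t) λ { refl → ¬x⋖y (∧-fst t) }))
      where x<z = covers-lt (∧-fst t)

    rank-x : rankIn P x x ≡ 0
    rank-x = rank-from-shape (shape-at-size z≤n (λ f → shape-refl f x)) ≤-refl

    rank-interior : ∀ {z} → T (lt P x z) → T (lt P z y) → rankIn P x z ≡ 1
    rank-interior x<z z<y = rank-from-shape
      (shape-at-size (chain-≤size (x≢z ⋖ (x⋖z , le-refl _) ∷ [ _ ]ᶜ)) (shape-cover x⋖z)) ≤-refl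
      where x⋖z = proj₁ (interior _ x<z z<y)
            x≢z = lt-≢ x<z

    rank-y : rankIn P x y ≡ 2
    rank-y = let (z , x<z , z<y) = witness
                 (x⋖z , z⋖y) = interior z x<z z<y
                 chain = x≢y ⋖ (x⋖z , lt-le z<y) ∷ (lt-≢ z<y ⋖ (z⋖y , le-refl y) ∷ [ y ]ᶜ)
             in rank-from-shape (shape-at-size (chain-≤size chain) (shape-two x≢y up-covered))
                                (count-pos (∈-allFin z) (∧-intro x⋖z (lt-le z<y)))

    rankParity : Bool → X → Bool
    rankParity b z = le x z ∧ le z y ∧ ⌊ isEven P (rankIn P x z) ≟B b ⌋

    parity-at : ∀ b z {l₁ l₂ r} → le x z ≡ l₁ → le z y ≡ l₂ → rankIn P x z ≡ r →
      rankParity b z ≡ (l₁ ∧ l₂ ∧ ⌊ isEven P r ≟B b ⌋)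
    parity-at b z refl refl refl = refl

    data Position (z : X) : Set where
      lower   : z ≡ x → Position z
      upper   : z ≡ y → Position z
      inside  : T (lt P x z) → T (lt P z y) → Position z
      outside : (le x z ∧ le z y) ≡ false → Position z

    position : ∀ z → Position z
    position z with z ≟F x | z ≟F y | le x z ∧ le z y in e
    ... | yes z≡x | _       | _     = lower z≡x
    ... | no _    | yes z≡y | _     = upper z≡y
    ... | no z≢x  | no z≢y  | true  = inside (lt-intro (∧-fst (≡→T e)) λ x≡z → z≢x (sym x≡z))
                                             (lt-intro (∧-snd {le x z} (≡→T e)) z≢y)
    ... | no _    | no _    | false = outside e

    outside-≢ : ∀ {z u} → (le x z ∧ le z y) ≡ false → T (le x u ∧ le u y) → eqF P z u ≡ false
    outside-≢ {z} e u-in = eqF-≢ λ { refl → subst T e u-in }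

    x-in : T (le x x ∧ le x y)
    x-in = ∧-intro (le-refl x) (lt-le x<y)

    y-in : T (le x y ∧ le y y)
    y-in = ∧-intro (lt-le x<y) (le-refl y)

    ≤x≤y : le x y ≡ true
    ≤x≤y = T→≡ (lt-le x<y)

    even-part : ∀ z → rankParity true z ≡ (eqF P z x ∨ eqF P z y)
    even-part z with position z
    ... | lower refl = trans (parity-at true x (T→≡ (le-refl x)) ≤x≤y rank-x)
                             (sym (cong (_∨ eqF P x y) (eqF-refl x)))
    ... | upper refl = trans (parity-at true y ≤x≤y (T→≡ (le-refl y)) rank-y)
                             (sym (cong₂ _∨_ (eqF-≢ (λ y≡x → x≢y (sym y≡x))) (eqF-refl y)))
    ... | inside x<z z<y = trans (parity-at true z (T→≡ (lt-le x<z)) (T→≡ (lt-le z<y)) (rank-interior x<z z<y))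
                             (sym (cong₂ _∨_ (eqF-≢ (λ z≡x → lt-≢ x<z (sym z≡x))) (eqF-≢ (lt-≢ z<y))))
    ... | outside e = trans (sym (∧-assoc (le x z) (le z y) _)) (trans (cong (_∧ _) e)
                             (sym (cong₂ _∨_ (outside-≢ e x-in) (outside-≢ e y-in))))

    odd-part : ∀ z → rankParity false z ≡ upCovers x y z
    odd-part z with position z
    ... | lower refl = trans (parity-at false x (T→≡ (le-refl x)) ≤x≤y rank-x)
                             (sym (cong (_∧ le x y) (¬T→≡false λ t → lt-≢ (covers-lt t) refl)))
    ... | upper refl = trans (parity-at false y ≤x≤y (T→≡ (le-refl y)) rank-y)
                             (sym (cong (_∧ le y y) (¬T→≡false ¬x⋖y)))
    ... | inside x<z z<y = trans (parity-at false z (T→≡ (lt-le x<z)) (T→≡ (lt-le z<y)) (rank-interior x<z z<y))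
                             (sym (cong₂ _∧_ (T→≡ (proj₁ (interior z x<z z<y))) (T→≡ (lt-le z<y))))
    ... | outside e = trans (sym (∧-assoc (le x z) (le z y) _)) (trans (cong (_∧ _) e)
                             (sym (¬T→≡false λ t → subst T e (∧-intro (lt-le (covers-lt (∧-fst t)))
                                                                     (∧-snd {covers P x z} t)))))

    two-interior : count (upCovers x y) (allFin size) ≡ 2
    two-interior = begin
      count (upCovers x y) (allFin size)          ≡⟨ count-cong (allFin size) odd-part ⟨
      countRankParity P false x y                 ≡⟨ euler x y x<y ⟨
      countRankParity P true x y                  ≡⟨ count-cong (allFin size) even-part ⟩
      count (λ z → eqF P z x ∨ eqF P z y) (allFin size)
        ≡⟨ count-∨ (allFin size) (λ z z≡x z≡y → x≢y (trans (sym (eqF-≡ z≡x)) (eqF-≡ z≡y))) ⟩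
      count (λ z → eqF P z x) (allFin size) + count (λ z → eqF P z y) (allFin size)
        ≡⟨ cong₂ _+_ (count-eqF x) (count-eqF y) ⟩
      2                                           ∎
      where open ≡-Reasoning

module RankThree (P : FinPoset) (rank3 : IntervalLength P (FinPoset.bot P) (FinPoset.top P) 3) where
  open Poset P

  atom coatom : X → Bool
  atom x = covers P bot x
  coatom x = covers P x top

  three-steps : ∀ {k c} → Chain k bot top c → k ≡ 3
  three-steps c = suc-injective (trans (sym (chain-length c)) (All.lookup (proj₂ rank3) (chain-maximal c)))

  bot≢top : bot ≢ top
  bot≢top e with three-steps (subst (λ t → Chain 0 bot t (bot ∷ [])) e [ bot ]ᶜ)
  ... | ()

  ¬bot⋖top : T (covers P bot top) → ⊥
  ¬bot⋖top b⋖t with three-steps (bot≢top ⋖ (b⋖t , le-refl top) ∷ [ top ]ᶜ)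
  ... | ()

  ¬atom-coatom : ∀ {x} → T (atom x) → T (coatom x) → ⊥
  ¬atom-coatom {x} a c
    with three-steps (bot≢top ⋖ (a , top-max x) ∷ (lt-≢ (covers-lt c) ⋖ (c , le-refl top) ∷ [ top ]ᶜ))
  ... | ()

  3≤size : 3 ≤ size
  3≤size = let (k , _ , c) = saturated-chain (bot-min top) in subst (_≤ size) (three-steps c) (chain-≤size c)

  -- Every element is 0̂, 1̂, an atom or a coatom: a chain through it has three steps.
  data Kind (z : X) : Set where
    is-bot    : z ≡ bot → Kind z
    is-top    : z ≡ top → Kind z
    is-atom   : T (atom z) → Kind z
    is-coatom : T (coatom z) → Kind z

  kind : ∀ z → Kind z
  kind z with z ≟F bot | z ≟F top
  ... | yes z≡bot | _ = is-bot z≡bot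
  ... | no _ | yes z≡top = is-top z≡top
  ... | no z≢bot | no z≢top =
    let (_ , _ , c₁) = saturated-chain (bot-min z)
        (_ , _ , c₂) = saturated-chain (top-max z)
    in split c₁ c₂ (three-steps (proj₂ (chain-++ c₁ c₂)))
    where
    split : ∀ {k₁ k₂ c₁ c₂} → Chain k₁ bot z c₁ → Chain k₂ z top c₂ → k₁ + k₂ ≡ 3 → Kind z
    split {0} c₁ _ _ = ⊥-elim (z≢bot (sym (chain-zero c₁)))
    split {1} c₁ _ _ = is-atom (chain-one c₁)
    split {2} {1} _ c₂ _ = is-coatom (chain-one c₂)
    split {3} {0} _ c₂ _ = ⊥-elim (z≢top (chain-zero c₂))
    split {2} {0} _ _ ()
    split {2} {suc (suc _)} _ _ ()
    split {3} {suc _} _ _ ()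
    split {suc (suc (suc (suc _)))} _ _ ()

  atom≢bot : ∀ {a} → T (atom a) → a ≢ bot
  atom≢bot t e = lt-≢ (covers-lt t) (sym e)

  atom≢top : ∀ {a} → T (atom a) → a ≢ top
  atom≢top t refl = ¬bot⋖top t

  coatom≢bot : ∀ {e} → T (coatom e) → e ≢ bot
  coatom≢bot t refl = ¬bot⋖top t

  coatom≢top : ∀ {e} → T (coatom e) → e ≢ top
  coatom≢top t = lt-≢ (covers-lt t)

  atom≢coatom : ∀ {a e} → T (atom a) → T (coatom e) → a ≢ e
  atom≢coatom ta te refl = ¬atom-coatom ta te

  below-atom : ∀ {a x} → T (atom a) → T (le x a) → x ≡ bot ⊎ x ≡ a
  below-atom {a} {x} ta x≤a with x ≟F bot | x ≟F a
  ... | yes e | _ = inj₁ e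
  ... | no _ | yes e = inj₂ e
  ... | no x≢bot | no x≢a = ⊥-elim (covers-empty ta (lt-intro (bot-min x) λ e → x≢bot (sym e)) (lt-intro x≤a x≢a))

  above-coatom : ∀ {e x} → T (coatom e) → T (le e x) → x ≡ e ⊎ x ≡ top
  above-coatom {e} {x} te e≤x with x ≟F e | x ≟F top
  ... | yes q | _ = inj₁ q
  ... | no _ | yes q = inj₂ q
  ... | no x≢e | no x≢top = ⊥-elim (covers-empty te (lt-intro e≤x λ q → x≢e (sym q)) (lt-intro (top-max x) x≢top))

  atom-≤-atom : ∀ {a a′} → T (atom a) → T (atom a′) → T (le a a′) → a ≡ a′
  atom-≤-atom ta ta′ a≤a′ with below-atom ta′ a≤a′
  ... | inj₁ e = ⊥-elim (atom≢bot ta e)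
  ... | inj₂ e = e

  coatom-≤-coatom : ∀ {e e′} → T (coatom e) → T (coatom e′) → T (le e e′) → e ≡ e′
  coatom-≤-coatom te te′ e≤e′ with above-coatom te e≤e′
  ... | inj₁ q = sym q
  ... | inj₂ q = ⊥-elim (coatom≢top te′ q)

  ¬coatom-≤-atom : ∀ {e a} → T (coatom e) → T (atom a) → T (le e a) → ⊥
  ¬coatom-≤-atom te ta e≤a with below-atom ta e≤a
  ... | inj₁ q = coatom≢bot te q
  ... | inj₂ refl = ¬atom-coatom ta te

  atom-⋖-coatom : ∀ {a e} → T (atom a) → T (coatom e) → T (le a e) → T (covers P a e)
  atom-⋖-coatom {a} {e} ta te a≤e = covers-intro (lt-intro a≤e (atom≢coatom ta te)) empty
    where
    empty : ∀ w → T (lt P a w) → T (lt P w e) → ⊥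
    empty w a<w w<e with kind w
    ... | is-bot refl = atom≢bot ta (≤-antisym-bot (lt-le a<w))
    ... | is-top refl = coatom≢top te (≤-antisym-top (lt-le w<e))
    ... | is-atom tw = lt-≢ a<w (atom-≤-atom ta tw (lt-le a<w))
    ... | is-coatom tw = lt-≢ w<e (coatom-≤-coatom tw te (lt-le w<e))

  covers-atom : ∀ {a x} → T (atom a) → T (covers P a x) → T (coatom x)
  covers-atom {a} {x} ta a⋖x with kind x
  ... | is-bot refl = ⊥-elim (atom≢bot ta (≤-antisym-bot (lt-le (covers-lt a⋖x))))
  ... | is-top refl = ⊥-elim (¬atom-coatom ta a⋖x)
  ... | is-atom tx = ⊥-elim (lt-≢ (covers-lt a⋖x) (atom-≤-atom ta tx (lt-le (covers-lt a⋖x))))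
  ... | is-coatom tx = tx

  interior-below-coatom : ∀ {e} → T (coatom e) → ∀ z → T (lt P bot z) → T (lt P z e) →
    T (covers P bot z) × T (covers P z e)
  interior-below-coatom te z b<z z<e with kind z
  ... | is-bot refl = ⊥-elim (lt-≢ b<z refl)
  ... | is-top refl = ⊥-elim (coatom≢top te (≤-antisym-top (lt-le z<e)))
  ... | is-atom tz = tz , atom-⋖-coatom tz te (lt-le z<e)
  ... | is-coatom tz = ⊥-elim (lt-≢ z<e (coatom-≤-coatom tz te (lt-le z<e)))

  interior-above-atom : ∀ {a} → T (atom a) → ∀ z → T (lt P a z) → T (lt P z top) →
    T (covers P a z) × T (covers P z top)
  interior-above-atom ta z a<z z<t with kind z
  ... | is-bot refl = ⊥-elim (atom≢bot ta (≤-antisym-bot (lt-le a<z)))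
  ... | is-top refl = ⊥-elim (lt-≢ z<t refl)
  ... | is-atom tz = ⊥-elim (lt-≢ a<z (atom-≤-atom ta tz (lt-le a<z)))
  ... | is-coatom tz = atom-⋖-coatom ta tz (lt-le a<z) , tz

  -- The first step of a saturated chain provides atoms and coatoms.

  atom-below : ∀ {e} → T (coatom e) → Σ X λ a → T (atom a) × T (le a e)
  atom-below {e} te with saturated-chain (bot-min e)
  ... | _ , _ , [ _ ]ᶜ = ⊥-elim (coatom≢bot te refl)
  ... | _ , _ , (_⋖_∷_ {z = a} _ (b⋖a , a≤e) _) = a , b⋖a , a≤e

  coatom-above : ∀ {a} → T (atom a) → Σ X λ e → T (coatom e) × T (le a e)
  coatom-above {a} ta with saturated-chain (top-max a)
  ... | _ , _ , [ _ ]ᶜ = ⊥-elim (atom≢top ta refl)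
  ... | _ , _ , (_⋖_∷_ {z = e} _ (a⋖e , _) _) = e , covers-atom ta a⋖e , lt-le (covers-lt a⋖e)

  some-coatom : Σ X λ e → T (coatom e)
  some-coatom with saturated-chain (bot-min top)
  ... | _ , _ , [ _ ]ᶜ = ⊥-elim (bot≢top refl)
  ... | _ , _ , (_⋖_∷_ {z = a} _ (b⋖a , _) _) = let (e , te , _) = coatom-above b⋖a in e , te

  shape-below-coatom : ∀ {e} → T (coatom e) → Shape size bot e 2 (count (upCovers bot e) (allFin size))
  shape-below-coatom te = shape-at-size (≤-trans (n≤1+n 2) 3≤size)
    (shape-two (λ e → coatom≢bot te (sym e)) (λ z t → atom-⋖-coatom (∧-fst t) te (∧-snd {atom z} t)))

  shape-whole : (∀ {a} → T (atom a) → count (upCovers a top) (allFin size) ≡ 2) →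
    Shape size bot top 3 (2 * count (upCovers bot top) (allFin size))
  shape-whole two-above = shape-at-size 3≤size λ f → shape-step (2 + f) bot≢top
    (λ a t → subst (Shape (2 + f) a top 2) (two-above (∧-fst t))
      (shape-two (atom≢top (∧-fst t)) (λ z u → proj₂ (interior-above-atom (∧-fst t) z
                   (covers-lt (∧-fst u)) (lt-intro (top-max z) λ { refl → ¬atom-coatom (∧-fst t) (∧-fst u) }))) f))
    refl

  module Eulerian (eulerian : IsEulerian P) where

    two-below : ∀ {e} → T (coatom e) → count (upCovers bot e) (allFin size) ≡ 2
    two-below {e} te = Diamond.two-interior eulerian
      (lt-intro (bot-min e) λ b≡e → coatom≢bot te (sym b≡e)) (interior-below-coatom te)
      (let (a , ta , a≤e) = atom-below te
       in a , covers-lt ta , lt-intro a≤e (atom≢coatom ta te))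

    two-above : ∀ {a} → T (atom a) → count (upCovers a top) (allFin size) ≡ 2
    two-above {a} ta = Diamond.two-interior eulerian
      (lt-intro (top-max a) (atom≢top ta)) (interior-above-atom ta)
      (let (e , te , a≤e) = coatom-above ta
       in e , lt-intro a≤e (atom≢coatom ta te) , covers-lt te)

other-in : ∀ {n} → List (Fin n) → Fin n → Fin n
other-in (u ∷ v ∷ _) x = if ⌊ x ≟F u ⌋ then v else u
other-in _ x = x

first-in : ∀ {n} → List (Fin n) → Fin n → Fin n
first-in (u ∷ _) _ = u
first-in [] x = x

-- For a test p on Fin n: `other x` is the element passing p other than x, and `some d`
-- an element passing p (d is a default).  Their properties need p to pass exactly two.
module Pair {n} (p : Fin n → Bool) where

  other : Fin n → Fin n
  other = other-in (filterᵇ p (allFin n))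

  some : Fin n → Fin n
  some = first-in (filterᵇ p (allFin n))

  module _ (two : count p (allFin n) ≡ 2) where
    private
      pair = count-two p (Unique.allFin⁺ n) two
      u = proj₁ pair
      v = proj₁ (proj₂ pair)
      u≢v : u ≢ v
      u≢v = proj₂ (proj₂ (proj₂ pair))
      filtered : filterᵇ p (allFin n) ≡ u ∷ v ∷ []
      filtered = proj₁ (proj₂ (proj₂ pair))

      members : ∀ {z} → T (p z) → z ≡ u ⊎ z ≡ v
      members {z} pz with subst (z ∈_) filtered (∈-filterᵇ⁺ (∈-allFin z) pz)
      ... | here z≡u = inj₁ z≡u
      ... | there (here z≡v) = inj₂ z≡v

      member-p : ∀ {z} → z ∈ u ∷ v ∷ [] → T (p z)
      member-p {z} z∈ = proj₂ (∈-filterᵇ⁻ (allFin n) (subst (z ∈_) (sym filtered) z∈))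

      other-u : other u ≡ v
      other-u = on-pair filtered
        where
        on-pair : ∀ {M} → M ≡ u ∷ v ∷ [] → other-in M u ≡ v
        on-pair refl with u ≟F u
        ... | yes _ = refl
        ... | no u≢u = ⊥-elim (u≢u refl)

      other-v : other v ≡ u
      other-v = on-pair filtered
        where
        on-pair : ∀ {M} → M ≡ u ∷ v ∷ [] → other-in M v ≡ u
        on-pair refl with v ≟F u
        ... | yes v≡u = ⊥-elim (u≢v (sym v≡u))
        ... | no _ = refl

    other-p : ∀ {x} → T (p x) → T (p (other x))
    other-p px with members px
    ... | inj₁ refl = subst (λ w → T (p w)) (sym other-u) (member-p (there (here refl)))
    ... | inj₂ refl = subst (λ w → T (p w)) (sym other-v) (member-p (here refl))

    other-≢ : ∀ {x} → T (p x) → other x ≢ x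
    other-≢ px with members px
    ... | inj₁ refl = λ e → u≢v (trans (sym e) other-u)
    ... | inj₂ refl = λ e → u≢v (trans (sym other-v) e)

    other-involutive : ∀ {x} → T (p x) → other (other x) ≡ x
    other-involutive px with members px
    ... | inj₁ refl = trans (cong other other-u) other-v
    ... | inj₂ refl = trans (cong other other-v) other-u

    other-all : ∀ {x z} → T (p x) → T (p z) → z ≡ x ⊎ z ≡ other x
    other-all px pz with members px | members pz
    ... | inj₁ refl | inj₁ e = inj₁ e
    ... | inj₁ refl | inj₂ e = inj₂ (trans e (sym other-u))
    ... | inj₂ refl | inj₁ e = inj₂ (trans e (sym other-v))
    ... | inj₂ refl | inj₂ e = inj₁ e

    some-p : ∀ {d} → T (p (some d))
    some-p {d} = on-pair filtered
      where
      on-pair : ∀ {M} → M ≡ u ∷ v ∷ [] → T (p (first-in M d))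
      on-pair refl = member-p (here refl)

-- Bounded search: the least k′ ∈ [k, k + f) with p k′ (or k + f if there is none).
search : (ℕ → Bool) → ℕ → ℕ → ℕ
search p k zero = k
search p k (suc f) = if p k then k else search p (suc k) f

search-≥ : ∀ (p : ℕ → Bool) k f → k ≤ search p k f
search-≥ p k zero = ≤-refl
search-≥ p k (suc f) with p k
... | true = ≤-refl
... | false = ≤-trans (n≤1+n k) (search-≥ p (suc k) f)

search-minimal : ∀ (p : ℕ → Bool) k f i → k ≤ i → i < search p k f → p i ≡ false
search-minimal p k zero i k≤i i< = ⊥-elim (<-irrefl refl (≤-trans i< k≤i))
search-minimal p k (suc f) i k≤i i< with p k in e
... | true = ⊥-elim (<-irrefl refl (≤-trans i< k≤i))
... | false with m≤n⇒m<n∨m≡n k≤i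
...   | inj₁ k<i = search-minimal p (suc k) f i k<i i<
...   | inj₂ refl = e

search-found : ∀ (p : ℕ → Bool) k f j → p j ≡ true → k ≤ j → j < k + f → p (search p k f) ≡ true
search-found p k zero j pj k≤j j< = ⊥-elim (<-irrefl refl (≤-trans j< (≤-trans (≤-reflexive (+-identityʳ k)) k≤j)))
search-found p k (suc f) j pj k≤j j< with p k in e
... | true = e
... | false with m≤n⇒m<n∨m≡n k≤j
...   | inj₁ k<j = search-found p (suc k) f j pj k<j (subst (j <_) (+-suc k f) j<)
...   | inj₂ refl = ⊥-elim (subst T e (≡→T pj))

-- Positions j, j′ of a q-cycle such that vertex j lies on edge j′ (which joins the
-- vertices j′ and j′ + 1 mod q).
Adjacent : ∀ {q} (j j′ : Fin q) → Set
Adjacent {q} j j′ = (toℕ j ≡ toℕ j′) ⊎ (toℕ j ≡ suc (toℕ j′)) ⊎ (toℕ j ≡ 0 × suc (toℕ j′) ≡ q)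

adjacent⇒face-inc : ∀ {q} (j j′ : Fin q) → Adjacent j j′ → T (⌊ j ≟F j′ ⌋ ∨ isNext j′ j)
adjacent⇒face-inc j j′ (inj₁ e) with j ≟F j′
... | yes _ = tt
... | no j≢j′ = ⊥-elim (j≢j′ (toℕ-injective e))
adjacent⇒face-inc j j′ (inj₂ (inj₁ e)) = ∨-inj₂ {⌊ j ≟F j′ ⌋} (∨-inj₁ (≡⇒≡ᵇ (toℕ j) (suc (toℕ j′)) e))
adjacent⇒face-inc {q} j j′ (inj₂ (inj₂ (j≡0 , j′+1≡q))) = ∨-inj₂ {⌊ j ≟F j′ ⌋}
  (∨-inj₂ {toℕ j ≡ᵇ suc (toℕ j′)} (∧-intro (≡⇒≡ᵇ (toℕ j) 0 j≡0) (≡⇒≡ᵇ (suc (toℕ j′)) q j′+1≡q)))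

face-inc⇒adjacent : ∀ {q} (j j′ : Fin q) → T (⌊ j ≟F j′ ⌋ ∨ isNext j′ j) → Adjacent j j′
face-inc⇒adjacent {q} j j′ t with j ≟F j′
... | yes refl = inj₁ refl
... | no _ with ∨-elim {toℕ j ≡ᵇ suc (toℕ j′)} t
...   | inj₁ t₁ = inj₂ (inj₁ (≡ᵇ⇒≡ (toℕ j) (suc (toℕ j′)) t₁))
...   | inj₂ t₂ = inj₂ (inj₂ (≡ᵇ⇒≡ (toℕ j) 0 (∧-fst t₂) , ≡ᵇ⇒≡ (suc (toℕ j′)) q (∧-snd {toℕ j ≡ᵇ 0} t₂)))

module Cycles (n : ℕ) (inc : Fin n → Fin n → Bool) (isA isC : Fin n → Bool)
  (two-atoms : ∀ {e} → T (isC e) → count (λ z → isA z ∧ inc z e) (allFin n) ≡ 2)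
  (two-coatoms : ∀ {a} → T (isA a) → count (λ z → isC z ∧ inc a z) (allFin n) ≡ 2) where

  otherA : Fin n → Fin n → Fin n
  otherA e = Pair.other (λ z → isA z ∧ inc z e)

  otherC : Fin n → Fin n → Fin n
  otherC a = Pair.other (λ z → isC z ∧ inc a z)

  firstC : Fin n → Fin n
  firstC a = Pair.some (λ z → isC z ∧ inc a z) a

  module _ {e a} (te : T (isC e)) (ta : T (isA a)) (a-e : T (inc a e)) where
    private
      other-p = Pair.other-p (λ z → isA z ∧ inc z e) (two-atoms te) (∧-intro ta a-e)

    otherA-atom : T (isA (otherA e a))
    otherA-atom = ∧-fst other-p

    otherA-inc : T (inc (otherA e a) e)
    otherA-inc = ∧-snd {isA (otherA e a)} other-p

    otherA-≢ : otherA e a ≢ a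
    otherA-≢ = Pair.other-≢ (λ z → isA z ∧ inc z e) (two-atoms te) (∧-intro ta a-e)

    otherA-invol : otherA e (otherA e a) ≡ a
    otherA-invol = Pair.other-involutive (λ z → isA z ∧ inc z e) (two-atoms te) (∧-intro ta a-e)

    otherA-all : ∀ {z} → T (isA z) → T (inc z e) → z ≡ a ⊎ z ≡ otherA e a
    otherA-all tz z-e = Pair.other-all (λ z → isA z ∧ inc z e) (two-atoms te) (∧-intro ta a-e) (∧-intro tz z-e)

  module _ {a e} (ta : T (isA a)) (te : T (isC e)) (a-e : T (inc a e)) where
    private
      other-p = Pair.other-p (λ z → isC z ∧ inc a z) (two-coatoms ta) (∧-intro te a-e)

    otherC-coatom : T (isC (otherC a e))
    otherC-coatom = ∧-fst other-p

    otherC-inc : T (inc a (otherC a e))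
    otherC-inc = ∧-snd {isC (otherC a e)} other-p

    otherC-≢ : otherC a e ≢ e
    otherC-≢ = Pair.other-≢ (λ z → isC z ∧ inc a z) (two-coatoms ta) (∧-intro te a-e)

    otherC-invol : otherC a (otherC a e) ≡ e
    otherC-invol = Pair.other-involutive (λ z → isC z ∧ inc a z) (two-coatoms ta) (∧-intro te a-e)

    otherC-all : ∀ {z} → T (isC z) → T (inc a z) → z ≡ e ⊎ z ≡ otherC a e
    otherC-all tz a-z = Pair.other-all (λ z → isC z ∧ inc a z) (two-coatoms ta) (∧-intro te a-e) (∧-intro tz a-z)

  firstC-coatom : ∀ {a} → T (isA a) → T (isC (firstC a))
  firstC-coatom {a} ta = ∧-fst (Pair.some-p (λ z → isC z ∧ inc a z) (two-coatoms ta) {a})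

  firstC-inc : ∀ {a} → T (isA a) → T (inc a (firstC a))
  firstC-inc {a} ta = ∧-snd {isC (firstC a)} (Pair.some-p (λ z → isC z ∧ inc a z) (two-coatoms ta) {a})

  -- Flags (a , c) of an atom on a coatom, and the rotation moving along a cycle:
  -- step to the other atom a′ of c, then to the other coatom of a′.

  Flag : Set
  Flag = Fin n × Fin n

  Valid : Flag → Set
  Valid (a , c) = T (isA a) × T (isC c) × T (inc a c)

  rotate : Flag → Flag
  rotate (a , c) = otherA c a , otherC (otherA c a) c

  rotate-valid : ∀ {d} → Valid d → Valid (rotate d)
  rotate-valid (ta , tc , a-c) =
    otherA-atom tc ta a-c , otherC-coatom (otherA-atom tc ta a-c) tc (otherA-inc tc ta a-c) ,
    otherC-inc (otherA-atom tc ta a-c) tc (otherA-inc tc ta a-c)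

  -- rotation is injective on valid flags, as both `other` maps are involutions
  rotate-injective : ∀ {d d′} → Valid d → Valid d′ → rotate d ≡ rotate d′ → d ≡ d′
  rotate-injective {a , c} {a′ , c′} (ta , tc , a-c) (ta′ , tc′ , a-c′) e = cong₂ _,_ a≡a′ c≡c′
    where
    c≡c′ : c ≡ c′
    c≡c′ = trans (sym (otherC-invol (otherA-atom tc ta a-c) tc (otherA-inc tc ta a-c)))
             (trans (cong₂ otherC (cong proj₁ e) (cong proj₂ e))
                    (otherC-invol (otherA-atom tc′ ta′ a-c′) tc′ (otherA-inc tc′ ta′ a-c′)))
    a≡a′ : a ≡ a′
    a≡a′ = trans (sym (otherA-invol tc ta a-c)) (trans (cong₂ otherA c≡c′ (cong proj₁ e)) (otherA-invol tc′ ta′ a-c′))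

  walk : ℕ → Flag → Flag
  walk zero d = d
  walk (suc k) d = rotate (walk k d)

  walk-valid : ∀ k {d} → Valid d → Valid (walk k d)
  walk-valid zero v = v
  walk-valid (suc k) v = rotate-valid (walk-valid k v)

  walk-+ : ∀ k m d → walk (k + m) d ≡ walk k (walk m d)
  walk-+ zero m d = refl
  walk-+ (suc k) m d = cong rotate (walk-+ k m d)

  walk-suc : ∀ k d → walk (suc k) d ≡ walk k (rotate d)
  walk-suc k d = trans (cong (λ t → walk t d) (+-comm 1 k)) (walk-+ k 1 d)

  walk-injective : ∀ k {d d′} → Valid d → Valid d′ → walk k d ≡ walk k d′ → d ≡ d′
  walk-injective zero v v′ e = e
  walk-injective (suc k) v v′ e = walk-injective k v v′ (rotate-injective (walk-valid k v) (walk-valid k v′) e)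

  -- The walk from a valid flag returns to it within n * n steps (pigeonhole on flags).
  recurrence : ∀ {d} → Valid d → Σ ℕ λ k → 1 ≤ k × k ≤ n * n × walk k d ≡ d
  recurrence {d} v with pigeonhole ≤-refl (λ (i : Fin (suc (n * n))) → encode (walk (toℕ i) d))
    where
    encode : Flag → Fin (n * n)
    encode (a , c) = combine a c
  ... | i , j , i<j , same =
    δ , m<n⇒0<n∸m i<j , ≤-trans (m∸n≤m (toℕ j) (toℕ i)) (≤-pred (toℕ<n j)) ,
    walk-injective (toℕ i) (walk-valid δ v) v (trans (sym (walk-+ (toℕ i) δ d))
      (trans (cong (λ t → walk t d) (m+[n∸m]≡n (<⇒≤ i<j))) (sym (decode same))))
    where
    δ = toℕ j ∸ toℕ i
    decode : ∀ {d d′ : Flag} → combine (proj₁ d) (proj₂ d) ≡ combine (proj₁ d′) (proj₂ d′) → d ≡ d′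
    decode {a , c} {a′ , c′} e = let (a≡a′ , c≡c′) = combine-injective a c a′ c′ e in cong₂ _,_ a≡a′ c≡c′

  _≟flag_ : DecidableEquality Flag
  _≟flag_ = ≡-dec _≟F_ _≟F_

  returnsAt : Flag → ℕ → Bool
  returnsAt d k = ⌊ walk k d ≟flag d ⌋

  -- The period of a flag: the least k ≥ 1 with walk k d ≡ d (written as a successor).
  period′ : Flag → ℕ
  period′ d = pred (search (returnsAt d) 1 (n * n))

  period : Flag → ℕ
  period d = suc (period′ d)

  period≡search : ∀ d → period d ≡ search (returnsAt d) 1 (n * n)
  period≡search d = suc-pred (search (returnsAt d) 1 (n * n)) {{>-nonZero (search-≥ (returnsAt d) 1 (n * n))}}

  period-returns : ∀ {d} → Valid d → walk (period d) d ≡ d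
  period-returns {d} v =
    let (k , 1≤k , k≤ , returns) = recurrence v
        found = search-found (returnsAt d) 1 (n * n) k (T→≡ (fromWitness returns)) 1≤k (s≤s k≤)
    in toWitness (≡→T (subst (λ t → returnsAt d t ≡ true) (sym (period≡search d)) found))

  period-minimal : ∀ {d} i → 1 ≤ i → i < period d → walk i d ≢ d
  period-minimal {d} i 1≤i i<p returns =
    subst T (search-minimal (returnsAt d) 1 (n * n) i 1≤i (subst (i <_) (period≡search d) i<p)) (fromWitness returns)

  atomAt coatomAt : ℕ → Flag → Fin n
  atomAt k d = proj₁ (walk k d)
  coatomAt k d = proj₂ (walk k d)

  OnOrbit : Flag → Fin n → Set
  OnOrbit d b = Σ ℕ λ j → atomAt j d ≡ b

  private
    around : ∀ k p → k + 1 * suc p ≡ suc (k + p)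
    around = solve-∀
    forward : ∀ i K p → i + K * p + K ≡ i + K * suc p
    forward = solve-∀
    backward : ∀ j W p → j + (W + j * p) ≡ W + j * suc p
    backward = solve-∀
    backward′ : ∀ W i p → suc W + i * p + (i + p) ≡ W + suc i * suc p
    backward′ = solve-∀
    shift : ∀ y Z p → y + (Z + y * p) ≡ Z + y * suc p
    shift = solve-∀
    even-split : ∀ y m → y + (m + m) ≡ m + (y + m)
    even-split = solve-∀
    odd-split : ∀ y m → y + suc (m + m) ≡ suc m + (y + m)
    odd-split = solve-∀

  halve : ∀ t → Σ ℕ λ m → (t ≡ m + m) ⊎ (t ≡ suc (m + m))
  halve zero = 0 , inj₁ refl
  halve (suc t) with halve t
  ... | m , inj₁ e = m , inj₂ (cong suc e)
  ... | m , inj₂ e = suc m , inj₁ (trans (cong suc e) (cong suc (sym (+-suc m m))))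

  module Orbit {d : Flag} (v : Valid d) where

    p′ : ℕ
    p′ = period′ d

    valid-at : ∀ k → Valid (walk k d)
    valid-at k = walk-valid k v

    walk-multiple : ∀ t → walk (t * period d) d ≡ d
    walk-multiple zero = refl
    walk-multiple (suc t) =
      trans (walk-+ (period d) (t * period d) d) (trans (cong (walk (period d)) (walk-multiple t)) (period-returns v))

    walk-periodic : ∀ x t → walk (x + t * period d) d ≡ walk x d
    walk-periodic x t = trans (walk-+ x (t * period d) d) (cong (walk x) (walk-multiple t))

    walk-around : ∀ k → walk (suc (k + p′)) d ≡ walk k d
    walk-around k = subst (λ u → walk u d ≡ walk k d) (around k p′) (walk-periodic k 1)

    walk-mod : ∀ x → walk x d ≡ walk (x % period d) d
    walk-mod x = trans (cong (λ t → walk t d) (m≡m%n+[m/n]*n x (period d))) (walk-periodic (x % period d) (x / period d))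

    walk-apart : ∀ {x y} → x < y → y < period d → walk x d ≢ walk y d
    walk-apart {x} {y} x<y y<p e = period-minimal (y ∸ x) (m<n⇒0<n∸m x<y) (≤-<-trans (m∸n≤m y x) y<p)
      (walk-injective x (walk-valid (y ∸ x) v) v
        (trans (sym (walk-+ x (y ∸ x) d)) (trans (cong (λ t → walk t d) (m+[n∸m]≡n (<⇒≤ x<y))) (sym e))))

    walk-distinct : ∀ x y → x < period d → y < period d → walk x d ≡ walk y d → x ≡ y
    walk-distinct x y x<p y<p e with <-cmp x y
    ... | tri≈ _ x≡y _ = x≡y
    ... | tri< x<y _ _ = ⊥-elim (walk-apart x<y y<p e)
    ... | tri> _ _ y<x = ⊥-elim (walk-apart y<x x<p (sym e))

    atom-moves : ∀ k → atomAt (suc k) d ≢ atomAt k d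
    atom-moves k = let (ta , tc , a-c) = valid-at k in otherA-≢ tc ta a-c

    coatom-moves : ∀ k → coatomAt (suc k) d ≢ coatomAt k d
    coatom-moves k = let (ta , tc , a-c) = valid-at k in otherC-≢ (otherA-atom tc ta a-c) tc (otherA-inc tc ta a-c)

    -- A cycle has at least two atoms, since consecutive atoms differ.
    period≥2 : 2 ≤ period d
    period≥2 = s≤s (n≢0⇒n>0 λ p′≡0 →
      atom-moves 0 (cong proj₁ (subst (λ u → walk (suc u) d ≡ d) p′≡0 (period-returns v))))

    -- The reversed flags (a_{Z+1} , c_Z) are walked through backwards.
    reversed : ℕ → Flag
    reversed Z = atomAt (suc Z) d , coatomAt Z d

    rotate-reversed : ∀ k → rotate (reversed (suc k)) ≡ reversed k
    rotate-reversed k =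
      let (ta , tc , a-c) = valid-at k
          (ta₁ , tc₁ , a-c₁) = valid-at (suc k)
          back = otherA-invol tc₁ ta₁ a-c₁
      in cong₂ _,_ back (trans (cong (λ z → otherC z (coatomAt (suc k) d)) back)
                               (otherC-invol (otherA-atom tc ta a-c) tc (otherA-inc tc ta a-c)))

    walk-reversed : ∀ m Z → walk m (reversed (m + Z)) ≡ reversed Z
    walk-reversed zero Z = refl
    walk-reversed (suc m) Z = trans (walk-suc m _) (trans (cong (walk m) (rotate-reversed (m + Z))) (walk-reversed m Z))

    reversed-periodic : ∀ Z t → reversed (Z + t * period d) ≡ reversed Z
    reversed-periodic Z t = cong₂ _,_ (cong proj₁ (walk-periodic (suc Z) t)) (cong proj₂ (walk-periodic Z t))

    -- No flag of the walk is a reversed flag: walking on from a coincidence would force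
    -- two consecutive atoms or two consecutive coatoms to agree.
    no-reversal : ∀ y Z → walk y d ≢ reversed Z
    no-reversal y Z h with halve (Z + y * p′)
    ... | m , inj₁ t≡ = atom-moves (y + m) (sym (trans (cong (λ w → atomAt w d) (+-comm y m)) (cong proj₁ r)))
      where
      r : walk (m + y) d ≡ reversed (y + m)
      r = trans (walk-+ m y d) (trans (cong (walk m) h)
            (trans (cong (walk m) (sym (aligned t≡))) (walk-reversed m (y + m))))
        where
        aligned : Z + y * p′ ≡ m + m → reversed (m + (y + m)) ≡ reversed Z
        aligned e = trans (cong reversed (trans (sym (even-split y m)) (cong (y +_) (sym e))))
                          (trans (cong reversed (shift y Z p′)) (reversed-periodic Z y))
    ... | m , inj₂ t≡ = coatom-moves (y + m) (trans (cong (λ w → coatomAt (suc w) d) (+-comm y m)) (cong proj₂ r))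
      where
      r : walk (suc m + y) d ≡ reversed (y + m)
      r = trans (walk-+ (suc m) y d) (trans (cong (walk (suc m)) h)
            (trans (cong (walk (suc m)) (sym (aligned t≡))) (walk-reversed (suc m) (y + m))))
        where
        aligned : Z + y * p′ ≡ suc (m + m) → reversed (suc m + (y + m)) ≡ reversed Z
        aligned e = trans (cong reversed (trans (sym (odd-split y m)) (cong (y +_) (sym e))))
                          (trans (cong reversed (shift y Z p′)) (reversed-periodic Z y))

    -- A flag (b , e) at an atom b = aₖ of the walk is either a flag of the walk or a
    -- reversed flag: e is one of the two coatoms c_W , c_{W+1} at b = a_{W+1}.
    flag-at-orbit-atom : ∀ {k b e} → atomAt k d ≡ b → T (isC e) → T (inc b e) →
      ((b , e) ≡ walk (suc (k + p′)) d) ⊎ ((b , e) ≡ reversed (k + p′))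
    flag-at-orbit-atom {k} {b} {e} ak≡b te b-e with valid-at (k + p′)
    ... | (ta , tc , a-c) with otherC-all (otherA-atom tc ta a-c) tc (otherA-inc tc ta a-c) te
                                (subst (λ z → T (inc z e)) (sym b≡) b-e)
      where
      b≡ : atomAt (suc (k + p′)) d ≡ b
      b≡ = trans (cong proj₁ (walk-around k)) ak≡b
    ...   | inj₁ e≡ = inj₂ (cong₂ _,_ (sym (trans (cong proj₁ (walk-around k)) ak≡b)) e≡)
    ...   | inj₂ e≡ = inj₁ (cong₂ _,_ (sym (trans (cong proj₁ (walk-around k)) ak≡b)) e≡)

    atom-determines : ∀ x y → atomAt x d ≡ atomAt y d → walk x d ≡ walk y d
    atom-determines x y ax≡ay with flag-at-orbit-atom {x} ax≡ay (proj₁ (proj₂ (valid-at y))) (proj₂ (proj₂ (valid-at y)))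
    ... | inj₁ q = sym (trans q (walk-around x))
    ... | inj₂ q = ⊥-elim (no-reversal y (x + p′) q)

    coatom-determines : ∀ x y → coatomAt x d ≡ coatomAt y d → walk x d ≡ walk y d
    coatom-determines x y cx≡cy with valid-at x | valid-at y
    ... | (ta , tc , a-c) | (ta′ , _ , a-c′) with otherA-all tc ta a-c ta′ (subst (λ z → T (inc (atomAt y d) z)) (sym cx≡cy) a-c′)
    ...   | inj₁ q = atom-determines x y (sym q)
    ...   | inj₂ q = ⊥-elim (coatom-moves x (trans (cong proj₂ (atom-determines (suc x) y (sym q))) (sym cx≡cy)))

    same-orbit : ∀ {k b e} → atomAt k d ≡ b → T (isC e) → T (inc b e) →
      (∀ b′ → OnOrbit (b , e) b′ → OnOrbit d b′) × (∀ b′ → OnOrbit d b′ → OnOrbit (b , e) b′)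
    same-orbit {k} {b} {e} ak≡b te b-e with flag-at-orbit-atom {k} ak≡b te b-e
    ... | inj₁ q = (λ b′ (j , h) → j + K , trans (cong proj₁ (walk-+ j K d)) (trans (cong (atomAt j) (sym q)) h)) ,
                   (λ b′ (i , h) → i + K * p′ , trans (cong (atomAt (i + K * p′)) q)
                      (trans (cong proj₁ (sym (walk-+ (i + K * p′) K d)))
                        (trans (cong (λ u → atomAt u d) (forward i K p′)) (trans (cong proj₁ (walk-periodic i K)) h))))
      where K = suc (k + p′)
    ... | inj₂ q = (λ b′ (j , h) → suc (W + j * p′) ,
                      trans (sym (cong proj₁ (walk-reversed j (W + j * p′))))
                        (trans (cong (λ f → atomAt j f) (sym (trans q (ahead j)))) h)) ,
                   (λ b′ (i , h) → suc W + i * p′ ,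
                      trans (cong (atomAt (suc W + i * p′)) (trans q (sym (behind i))))
                        (trans (cong proj₁ (walk-reversed (suc W + i * p′) (i + p′)))
                          (trans (cong proj₁ (walk-around i)) h)))
      where
      W = k + p′
      ahead : ∀ j → reversed W ≡ reversed (j + (W + j * p′))
      ahead j = sym (trans (cong reversed (backward j W p′)) (reversed-periodic W j))
      behind : ∀ i → reversed (suc W + i * p′ + (i + p′)) ≡ reversed W
      behind i = trans (cong reversed (backward′ W i p′)) (reversed-periodic W (suc i))

    coatom-on-orbit : ∀ {k b e} → atomAt k d ≡ b → T (isC e) → T (inc b e) → Σ ℕ λ j → coatomAt j d ≡ e
    coatom-on-orbit {k} ak≡b te b-e with flag-at-orbit-atom {k} ak≡b te b-e
    ... | inj₁ q = suc (k + p′) , sym (cong proj₂ q)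
    ... | inj₂ q = k + p′ , sym (cong proj₂ q)

    index-mod : ∀ (g : Flag → Fin n) {b} → (Σ ℕ λ j → g (walk j d) ≡ b) →
      Σ (Fin (period d)) λ j → g (walk (toℕ j) d) ≡ b
    index-mod g (j , h) = fromℕ< (m%n<n j (period d)) ,
      trans (cong (λ u → g (walk u d)) (toℕ-fromℕ< (m%n<n j (period d)))) (trans (cong g (sym (walk-mod j))) h)

  start : Fin n → Flag
  start a = a , firstC a

  start-valid : ∀ {a} → T (isA a) → Valid (start a)
  start-valid ta = ta , firstC-coatom ta , firstC-inc ta

  same-cycle : ∀ {s b k} → Valid (start s) → atomAt k (start s) ≡ b →
    (∀ b′ → OnOrbit (start b) b′ → OnOrbit (start s) b′) × (∀ b′ → OnOrbit (start s) b′ → OnOrbit (start b) b′)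
  same-cycle {k = k} v ak≡b =
    let tb = subst (λ z → T (isA z)) ak≡b (proj₁ (walk-valid k v))
    in Orbit.same-orbit v {k} ak≡b (firstC-coatom tb) (firstC-inc tb)

  -- An atom represents its cycle if it has the least index among the atoms of the cycle.
  isRep : Fin n → Bool
  isRep a = isA a ∧ ⌊ all? (λ (j : Fin (period (start a))) → toℕ a ≤? toℕ (atomAt (toℕ j) (start a))) ⌋

  rep-atom : ∀ {a} → T (isRep a) → T (isA a)
  rep-atom = ∧-fst

  rep-min : ∀ {a} → T (isRep a) → ∀ j → toℕ a ≤ toℕ (atomAt j (start a))
  rep-min {a} t j = subst (λ u → toℕ a ≤ toℕ u) (cong proj₁ (sym (Orbit.walk-mod (start-valid (rep-atom t)) j)))
    (subst (λ u → toℕ a ≤ toℕ (atomAt u (start a))) (toℕ-fromℕ< j%p<p) (toWitness (∧-snd {isA a} t) (fromℕ< j%p<p)))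
    where j%p<p = m%n<n j (period (start a))

  rep-intro : ∀ {a} → T (isA a) → (∀ j → toℕ a ≤ toℕ (atomAt j (start a))) → T (isRep a)
  rep-intro ta least = ∧-intro ta (fromWitness (λ j → least (toℕ j)))

  least-on-cycle : ∀ {b} → T (isA b) → Σ (Fin n) λ m → T (isRep m) × OnOrbit (start m) b
  least-on-cycle {b} tb = m , rep-intro tm (λ j → let (i , h) = proj₁ same (atomAt j (start m)) (j , refl)
                                                   in subst (λ u → toℕ m ≤ toℕ u) h (least i)) ,
                          proj₂ same b (0 , refl)
    where
    v = start-valid tb
    atoms = map (λ j → atomAt j (start b)) (upTo (period (start b)))
    m = argmin toℕ b atoms
    on-cycle : OnOrbit (start b) m
    on-cycle = argmin-all toℕ {P = OnOrbit (start b)} (0 , refl)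
      (All.map⁺ {f = λ j → atomAt j (start b)} (All.universal (λ j → j , refl) (upTo (period (start b)))))
    tm : T (isA m)
    tm = subst (λ z → T (isA z)) (proj₂ on-cycle) (proj₁ (walk-valid (proj₁ on-cycle) v))
    same = Orbit.same-orbit v {proj₁ on-cycle} (proj₂ on-cycle) (firstC-coatom tm) (firstC-inc tm)
    least : ∀ i → toℕ m ≤ toℕ (atomAt i (start b))
    least i = subst (λ u → toℕ m ≤ toℕ u) (cong proj₁ (sym (Orbit.walk-mod v i)))
      (All.lookup (f[argmin]≤f[xs] {f = toℕ} b atoms) (∈-map⁺ (λ j → atomAt j (start b)) (∈-upTo⁺ (m%n<n i (period (start b))))))

  reps : List (Fin n)
  reps = filterᵇ isRep (allFin n)

  r : ℕ
  r = length reps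

  rep : Fin r → Fin n
  rep i = lookup reps i

  rep-isRep : ∀ i → T (isRep (rep i))
  rep-isRep i = proj₂ (∈-filterᵇ⁻ (allFin n) (∈-lookup i))

  rep-valid : ∀ i → Valid (start (rep i))
  rep-valid i = start-valid (rep-atom (rep-isRep i))

  -- Cycles sharing an atom are the same cycle: both representatives are least on it.
  one-rep-per-cycle : ∀ i i′ b → OnOrbit (start (rep i)) b → OnOrbit (start (rep i′)) b → i ≡ i′
  one-rep-per-cycle i i′ b (k , h) (k′ , h′) =
    let o  = same-cycle {k = k} (rep-valid i) h
        o′ = same-cycle {k = k′} (rep-valid i′) h′
        (j , e)  = proj₁ o′ (rep i) (proj₂ o (rep i) (0 , refl))
        (j′ , e′) = proj₁ o (rep i′) (proj₂ o′ (rep i′) (0 , refl))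
        ≤₁ = subst (λ u → toℕ (rep i′) ≤ toℕ u) e (rep-min (rep-isRep i′) j)
        ≤₂ = subst (λ u → toℕ (rep i) ≤ toℕ u) e′ (rep-min (rep-isRep i) j′)
    in lookup-injective reps (Unique.filter⁺ (λ x → T? (isRep x)) (Unique.allFin⁺ n)) i i′ (toℕ-injective (≤-antisym ≤₂ ≤₁))

  -- The length of cycle i, and its vertices (atoms) and edges (coatoms) in cyclic order.
  qs : Fin r → ℕ
  qs i = period (start (rep i))

  V E : (i : Fin r) → Fin (qs i) → Fin n
  V i j = atomAt (toℕ j) (start (rep i))
  E i j = coatomAt (toℕ j) (start (rep i))

  qs≥2 : ∀ i → 2 ≤ qs i
  qs≥2 i = Orbit.period≥2 (rep-valid i)

  V-atom : ∀ i j → T (isA (V i j))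
  V-atom i j = proj₁ (walk-valid (toℕ j) (rep-valid i))

  E-coatom : ∀ i j → T (isC (E i j))
  E-coatom i j = proj₁ (proj₂ (walk-valid (toℕ j) (rep-valid i)))

  V-surjective : ∀ {b} → T (isA b) → Σ (Fin r) λ i → Σ (Fin (qs i)) λ j → V i j ≡ b
  V-surjective {b} tb =
    let (m , rep-m , on) = least-on-cycle tb
        m∈ = ∈-filterᵇ⁺ {p = isRep} (∈-allFin m) rep-m
        i = Any.index m∈
        on-i = subst (λ s → OnOrbit (start s) b) (lookup-index m∈) on
    in i , Orbit.index-mod (rep-valid i) proj₁ on-i

  E-surjective : ∀ {e} → T (isC e) → Σ (Fin r) λ i → Σ (Fin (qs i)) λ j → E i j ≡ e
  E-surjective {e} te =
    let (b , tb-e) = satisfied-two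
        (i , j , h) = V-surjective (∧-fst tb-e)
    in i , Orbit.index-mod (rep-valid i) proj₂
             (Orbit.coatom-on-orbit (rep-valid i) {toℕ j} h te (∧-snd {isA b} tb-e))
    where
    satisfied-two : Σ (Fin n) λ b → T (isA b ∧ inc b e)
    satisfied-two with filterᵇ (λ z → isA z ∧ inc z e) (allFin n) in eq | two-atoms te
    ... | b ∷ _ | _ = b , proj₂ (∈-filterᵇ⁻ (allFin n) (subst (b ∈_) (sym eq) (here refl)))

  V-injective-within : ∀ i (j j′ : Fin (qs i)) → V i j ≡ V i j′ → j ≡ j′
  V-injective-within i j j′ e = toℕ-injective (Orbit.walk-distinct (rep-valid i) (toℕ j) (toℕ j′) (toℕ<n j) (toℕ<n j′)
    (Orbit.atom-determines (rep-valid i) (toℕ j) (toℕ j′) e))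

  E-injective-within : ∀ i (j j′ : Fin (qs i)) → E i j ≡ E i j′ → j ≡ j′
  E-injective-within i j j′ e = toℕ-injective (Orbit.walk-distinct (rep-valid i) (toℕ j) (toℕ j′) (toℕ<n j) (toℕ<n j′)
    (Orbit.coatom-determines (rep-valid i) (toℕ j) (toℕ j′) e))

  V-injective : ∀ i j i′ j′ → V i j ≡ V i′ j′ → i ≡ i′
  V-injective i j i′ j′ e = one-rep-per-cycle i i′ (V i j) (toℕ j , refl) (toℕ j′ , sym e)

  atom-on-edge : ∀ i′ j′ {b} → T (isA b) → T (inc b (E i′ j′)) → OnOrbit (start (rep i′)) b
  atom-on-edge i′ j′ tb b-e = on-edge (otherA-all tc ta a-c tb b-e)
    where
    ta = proj₁ (walk-valid (toℕ j′) (rep-valid i′))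
    tc = proj₁ (proj₂ (walk-valid (toℕ j′) (rep-valid i′)))
    a-c = proj₂ (proj₂ (walk-valid (toℕ j′) (rep-valid i′)))
    on-edge : ∀ {b} → b ≡ V i′ j′ ⊎ b ≡ otherA (E i′ j′) (V i′ j′) → OnOrbit (start (rep i′)) b
    on-edge (inj₁ q) = toℕ j′ , sym q
    on-edge (inj₂ q) = suc (toℕ j′) , sym q

  E-injective : ∀ i j i′ j′ → E i j ≡ E i′ j′ → i ≡ i′
  E-injective i j i′ j′ e =
    let (ta , tc , a-c) = walk-valid (toℕ j) (rep-valid i)
    in one-rep-per-cycle i i′ (V i j) (toℕ j , refl) (atom-on-edge i′ j′ ta (subst (λ z → T (inc (V i j) z)) e a-c))

  incidence-across : ∀ i j i′ j′ → i ≢ i′ → inc (V i j) (E i′ j′) ≡ false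
  incidence-across i j i′ j′ i≢i′ =
    ¬T→≡false λ t → i≢i′ (one-rep-per-cycle i i′ (V i j) (toℕ j , refl) (atom-on-edge i′ j′ (V-atom i j) t))

  incidence-within⇒adjacent : ∀ i (j j′ : Fin (qs i)) → T (inc (V i j) (E i j′)) → Adjacent j j′
  incidence-within⇒adjacent i j j′ t = on-edge (otherA-all tc ta a-c (V-atom i j) t)
    where
    v = rep-valid i
    ta = proj₁ (walk-valid (toℕ j′) v)
    tc = proj₁ (proj₂ (walk-valid (toℕ j′) v))
    a-c = proj₂ (proj₂ (walk-valid (toℕ j′) v))
    next : V i j ≡ atomAt (suc (toℕ j′)) (start (rep i)) → (suc (toℕ j′) < qs i) ⊎ (suc (toℕ j′) ≡ qs i) →
      Adjacent j j′
    next q (inj₁ j′+1<q) = inj₂ (inj₁ (Orbit.walk-distinct v (toℕ j) (suc (toℕ j′)) (toℕ<n j) j′+1<q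
                                        (Orbit.atom-determines v (toℕ j) (suc (toℕ j′)) q)))
    next q (inj₂ j′+1≡q) = inj₂ (inj₂ (Orbit.walk-distinct v (toℕ j) 0 (toℕ<n j) (s≤s z≤n) wraps , j′+1≡q))
      where
      wraps : walk (toℕ j) (start (rep i)) ≡ start (rep i)
      wraps = trans (Orbit.atom-determines v (toℕ j) (suc (toℕ j′)) q)
                (trans (Orbit.walk-mod v (suc (toℕ j′)))
                  (cong (λ u → walk u (start (rep i))) (trans (cong (_% qs i) j′+1≡q) (n%n≡0 (qs i)))))
    on-edge : V i j ≡ V i j′ ⊎ V i j ≡ otherA (E i j′) (V i j′) → Adjacent j j′
    on-edge (inj₁ q) = inj₁ (cong toℕ (V-injective-within i j j′ q))
    on-edge (inj₂ q) = next q (m≤n⇒m<n∨m≡n (toℕ<n j′))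

  adjacent⇒incidence-within : ∀ i (j j′ : Fin (qs i)) → Adjacent j j′ → T (inc (V i j) (E i j′))
  adjacent⇒incidence-within i j j′ = on-edge
    where
    d = start (rep i)
    ta = proj₁ (walk-valid (toℕ j′) (rep-valid i))
    tc = proj₁ (proj₂ (walk-valid (toℕ j′) (rep-valid i)))
    a-c = proj₂ (proj₂ (walk-valid (toℕ j′) (rep-valid i)))
    on-edge : Adjacent j j′ → T (inc (V i j) (E i j′))
    on-edge (inj₁ e) = subst (λ u → T (inc (atomAt u d) (E i j′))) (sym e) a-c
    on-edge (inj₂ (inj₁ e)) = subst (λ u → T (inc (atomAt u d) (E i j′))) (sym e) (otherA-inc tc ta a-c)
    on-edge (inj₂ (inj₂ (j≡0 , j′+1≡q))) = subst (λ u → T (inc u (E i j′))) wrap (otherA-inc tc ta a-c)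
      where
      wrap : atomAt (suc (toℕ j′)) d ≡ atomAt (toℕ j) d
      wrap = trans (cong (λ u → atomAt u d) (trans j′+1≡q (sym (+-identityʳ (qs i)))))
                   (trans (cong proj₁ (Orbit.walk-periodic (rep-valid i) 0 1)) (cong (λ u → atomAt u d) (sym j≡0)))

  incidence-within : ∀ i (j j′ : Fin (qs i)) → inc (V i j) (E i j′) ≡ (⌊ j ≟F j′ ⌋ ∨ isNext j′ j)
  incidence-within i j j′ = bool-ext (λ t → adjacent⇒face-inc j j′ (incidence-within⇒adjacent i j j′ t))
                                     (λ t → adjacent⇒incidence-within i j j′ (face-inc⇒adjacent j j′ t))

module Polygons (P : FinPoset) (eulerian : IsEulerian P)
  (rank3 : IntervalLength P (FinPoset.bot P) (FinPoset.top P) 3) where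
  open Poset P
  open RankThree P rank3
  open Eulerian eulerian

  two-coatoms : ∀ {a} → T (atom a) → count (λ z → coatom z ∧ le a z) (allFin size) ≡ 2
  two-coatoms {a} ta = trans (count-cong (allFin size) (λ z → sym (covers-of-atom z))) (two-above ta)
    where
    covers-of-atom : ∀ z → upCovers a top z ≡ (coatom z ∧ le a z)
    covers-of-atom z = bool-ext
      (λ t → ∧-intro (covers-atom ta (∧-fst t)) (lt-le (covers-lt (∧-fst t))))
      (λ t → ∧-intro (atom-⋖-coatom ta (∧-fst t) (∧-snd {coatom z} t)) (top-max z))

  private
    module C = Cycles size le atom coatom two-below two-coatoms

  -- The cycle decomposition is used only through the interface below; keeping it opaque
  -- stops the type checker from unfolding the enumeration of the cycles.
  opaque
    r : ℕ
    r = C.r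

    qs : Fin r → ℕ
    qs = C.qs

    qs≥2 : ∀ i → 2 ≤ qs i
    qs≥2 = C.qs≥2

    V E : (i : Fin r) → Fin (qs i) → X
    V = C.V
    E = C.E

    V-atom : ∀ i j → T (atom (V i j))
    V-atom = C.V-atom

    E-coatom : ∀ i j → T (coatom (E i j))
    E-coatom = C.E-coatom

    V-surjective : ∀ {b} → T (atom b) → Σ (Fin r) λ i → Σ (Fin (qs i)) λ j → V i j ≡ b
    V-surjective = C.V-surjective

    E-surjective : ∀ {e} → T (coatom e) → Σ (Fin r) λ i → Σ (Fin (qs i)) λ j → E i j ≡ e
    E-surjective = C.E-surjective

    V-injective : ∀ i j i′ j′ → V i j ≡ V i′ j′ → i ≡ i′
    V-injective = C.V-injective

    V-injective-within : ∀ i (j j′ : Fin (qs i)) → V i j ≡ V i j′ → j ≡ j′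
    V-injective-within = C.V-injective-within

    E-injective : ∀ i j i′ j′ → E i j ≡ E i′ j′ → i ≡ i′
    E-injective = C.E-injective

    E-injective-within : ∀ i (j j′ : Fin (qs i)) → E i j ≡ E i j′ → j ≡ j′
    E-injective-within = C.E-injective-within

    incidence-across : ∀ i j i′ j′ → i ≢ i′ → le (V i j) (E i′ j′) ≡ false
    incidence-across = C.incidence-across

    incidence-within : ∀ i (j j′ : Fin (qs i)) → le (V i j) (E i j′) ≡ (⌊ j ≟F j′ ⌋ ∨ isNext j′ j)
    incidence-within = C.incidence-within

  Q : Fin r → BOrd
  Q i = faceLattice (qs i)

  Glued : Set
  Glued = BoxElem Q (λ i → faceEq (qs i))

  leGlued : Glued → Glued → Bool
  leGlued = leBox Q (λ i → faceEq (qs i))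

  -- Vertex j of polygon i is the atom V i j and its edge j the coatom E i j.
  embed : Glued → X
  embed b0̂ = bot
  embed b1̂ = top
  embed (inner i f0̂ ())
  embed (inner i f1̂ ())
  embed (inner i (vtx j) _) = V i j
  embed (inner i (edge j) _) = E i j

  embed-surjective : ∀ x → Σ Glued λ g → embed g ≡ x
  embed-surjective x with kind x
  ... | is-bot e = b0̂ , sym e
  ... | is-top e = b1̂ , sym e
  ... | is-atom ta = let (i , j , h) = V-surjective ta in inner i (vtx j) tt , h
  ... | is-coatom tc = let (i , j , h) = E-surjective tc in inner i (edge j) tt , h

  embed-injective : ∀ g g′ → embed g ≡ embed g′ → g ≡ g′
  embed-injective b0̂ b0̂ e = refl
  embed-injective b0̂ b1̂ e = ⊥-elim (bot≢top e)
  embed-injective b0̂ (inner i (vtx j) _) e = ⊥-elim (atom≢bot (V-atom i j) (sym e))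
  embed-injective b0̂ (inner i (edge j) _) e = ⊥-elim (coatom≢bot (E-coatom i j) (sym e))
  embed-injective b1̂ b0̂ e = ⊥-elim (bot≢top (sym e))
  embed-injective b1̂ b1̂ e = refl
  embed-injective b1̂ (inner i (vtx j) _) e = ⊥-elim (atom≢top (V-atom i j) (sym e))
  embed-injective b1̂ (inner i (edge j) _) e = ⊥-elim (coatom≢top (E-coatom i j) (sym e))
  embed-injective (inner i (vtx j) _) b0̂ e = ⊥-elim (atom≢bot (V-atom i j) e)
  embed-injective (inner i (vtx j) _) b1̂ e = ⊥-elim (atom≢top (V-atom i j) e)
  embed-injective (inner i (vtx j) _) (inner i′ (vtx j′) _) e with V-injective i j i′ j′ e
  ... | refl with V-injective-within i j j′ e
  ...   | refl = refl
  embed-injective (inner i (vtx j) _) (inner i′ (edge j′) _) e = ⊥-elim (atom≢coatom (V-atom i j) (E-coatom i′ j′) e)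
  embed-injective (inner i (edge j) _) b0̂ e = ⊥-elim (coatom≢bot (E-coatom i j) e)
  embed-injective (inner i (edge j) _) b1̂ e = ⊥-elim (coatom≢top (E-coatom i j) e)
  embed-injective (inner i (edge j) _) (inner i′ (vtx j′) _) e = ⊥-elim (atom≢coatom (V-atom i′ j′) (E-coatom i j) (sym e))
  embed-injective (inner i (edge j) _) (inner i′ (edge j′) _) e with E-injective i j i′ j′ e
  ... | refl with E-injective-within i j j′ e
  ...   | refl = refl

  embed-order : ∀ g g′ → le (embed g) (embed g′) ≡ leGlued g g′
  embed-order b0̂ g′ = T→≡ (bot-min _)
  embed-order b1̂ b0̂ = ¬T→≡false (λ t → bot≢top (sym (≤-antisym-bot t)))
  embed-order b1̂ b1̂ = T→≡ (le-refl top)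
  embed-order b1̂ (inner i (vtx j) _) = ¬T→≡false (λ t → atom≢top (V-atom i j) (≤-antisym-top t))
  embed-order b1̂ (inner i (edge j) _) = ¬T→≡false (λ t → coatom≢top (E-coatom i j) (≤-antisym-top t))
  embed-order (inner i (vtx j) _) b0̂ = ¬T→≡false (λ t → atom≢bot (V-atom i j) (≤-antisym-bot t))
  embed-order (inner i (edge j) _) b0̂ = ¬T→≡false (λ t → coatom≢bot (E-coatom i j) (≤-antisym-bot t))
  embed-order (inner i (vtx j) _) b1̂ = T→≡ (top-max _)
  embed-order (inner i (edge j) _) b1̂ = T→≡ (top-max _)
  embed-order (inner i (vtx j) _) (inner i′ (vtx j′) _) with i ≟F i′
  ... | no i≢i′ = ¬T→≡false (λ t → i≢i′ (V-injective i j i′ j′ (atom-≤-atom (V-atom i j) (V-atom i′ j′) t)))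
  ... | yes refl with j ≟F j′
  ...   | yes refl = T→≡ (le-refl _)
  ...   | no j≢j′ = ¬T→≡false (λ t → j≢j′ (V-injective-within i j j′ (atom-≤-atom (V-atom i j) (V-atom i j′) t)))
  embed-order (inner i (vtx j) _) (inner i′ (edge j′) _) with i ≟F i′
  ... | no i≢i′ = incidence-across i j i′ j′ i≢i′
  ... | yes refl = incidence-within i j j′
  embed-order (inner i (edge j) _) (inner i′ (vtx j′) _) with i ≟F i′
  ... | no _ = ¬T→≡false (¬coatom-≤-atom (E-coatom i j) (V-atom i′ j′))
  ... | yes refl = ¬T→≡false (¬coatom-≤-atom (E-coatom i j) (V-atom i′ j′))
  embed-order (inner i (edge j) _) (inner i′ (edge j′) _) with i ≟F i′
  ... | no i≢i′ = ¬T→≡false (λ t → i≢i′ (E-injective i j i′ j′ (coatom-≤-coatom (E-coatom i j) (E-coatom i′ j′) t)))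
  ... | yes refl with j ≟F j′
  ...   | yes refl = T→≡ (le-refl _)
  ...   | no j≢j′ = ¬T→≡false (λ t → j≢j′ (E-injective-within i j j′ (coatom-≤-coatom (E-coatom i j) (E-coatom i j′) t)))

  polygons : Iso P (boxplus Q (λ i → faceEq (qs i)))
  polygons = mk↔ₛ′ project embed project-embed embed-project ,
             λ x y → trans (cong₂ le (sym (embed-project x)) (sym (embed-project y))) (embed-order (project x) (project y))
    where
    project : X → Glued
    project x = proj₁ (embed-surjective x)
    embed-project : ∀ x → embed (project x) ≡ x
    embed-project x = proj₂ (embed-surjective x)
    project-embed : ∀ g → project (embed g) ≡ g
    project-embed g = embed-injective _ _ (embed-project (embed g))

  -- The Sheffer factorial function: [0̂,e] has two maximal chains, [0̂,1̂] two per atom.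
  module Factorials {D B : ℕ → ℕ} (sheffer : IsSheffer P D B) where
    open IsSheffer sheffer using (D-spec)

    #atoms : ℕ
    #atoms = count (upCovers bot top) (allFin size)

    D2≡2 : D 2 ≡ 2
    D2≡2 = let (e , te) = some-coatom
               shape = shape-below-coatom te
           in trans (sym (D-spec e 2 (bot-min e , proj₁ shape))) (trans (proj₂ shape) (two-below te))

    D3≡2q : D 3 ≡ 2 * #atoms
    D3≡2q = trans (sym (D-spec top 3 rank3)) (proj₂ (shape-whole two-above))

    -- the two atoms below any coatom are atoms of P
    2≤#atoms : 2 ≤ #atoms
    2≤#atoms = let (e , te) = some-coatom in
      ≤-trans (≤-reflexive (sym (two-below te))) (count-mono (allFin size) (λ z t → ∧-intro (∧-fst t) (top-max z)))

lemma4p3 : (P : FinPoset) (D B : ℕ → ℕ) →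
    IsEulerian P → IsSheffer P D B →
    IntervalLength P (FinPoset.bot P) (FinPoset.top P) 3 →
    (D 2 ≡ 2 × Σ ℕ λ q → 2 ≤ q × D 3 ≡ 2 * q) ×
    (Σ ℕ λ r → Σ (Fin r → ℕ) λ qs → ((i : Fin r) → 2 ≤ qs i) ×
    Iso P (boxplus (λ i → faceLattice (qs i)) (λ i → faceEq (qs i))))
lemma4p3 P D B eulerian sheffer rank3 =
  (D2≡2 , #atoms , 2≤#atoms , D3≡2q) , r , qs , qs≥2 , polygons
  where
  open Polygons P eulerian rank3
  open Factorials sheffer
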